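{- Let $r\ge 2$ and $n\ge 0$. With $p_{n,\ell}^{(r)}$ the total number of peaks at level $\ell+1$ over all paths in $\mathcal{A}_{n+1,0}^{(r)}$ and $S_n^{(r)}=|\mathcal{A}_{n,0}^{(r)}|$, $$\sum_{\ell=0}^{n}(-1)^{\ell}p_{n,\ell}^{(r)}S_{\ell}^{(r)}=r\sum_{\ell=0}^{n}(-1)^{n-\ell}S_{\ell}^{(r)}S_{n-\ell}(-1,(r-1)^2),$$ $$\sum_{\ell=0}^{n}(-1)^{\ell}p_{n,\ell}^{(r)}\left(S_{\ell+1}^{(r)}-S_{\ell}^{(r)}\right)=\frac{r}{r-1}(-1)^{n}\left(S_{n+1}(-1,(r-1)^2)+S_n(-1,(r-1)^2)\right).$$ In particular, for $r=2$: $\sum_{\ell=0}^{n}(-1)^{\ell}p_{n,\ell}^{(2)}S_{\ell}=2S_n$ and $\sum_{\ell=0}^{n}(-1)^{\ell}p_{n,\ell}^{(2)}(S_{\ell+1}-S_{\ell})=2\delta_{n,0}$, where $S_n$ is the $n$th large Schröder number.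
   Context: A Dyck path of length $2n$ is a lattice path from $(0,0)$ to $(2n,0)$ weakly above the $x$-axis with steps $\mathbf{u}=(1,1)$, $\mathbf{d}=(1,-1)$; an $r$-colored Dyck path has each $\mathbf{d}$-step colored with one of $r$ colors. $\mathcal{A}_{n,0}^{(r)}$ is the set of $r$-colored Dyck paths of length $2n$ with no two consecutive $\mathbf{d}$-steps of the same color. A peak is an occurrence of a $\mathbf{u}$-step immediately followed by a $\mathbf{d}$-step; its level is the ordinate of the common point of the two steps. For parameters $a,b$, $S_n(a,b)=\sum_{k=0}^{n}\binom{n+k}{2k}C_k a^{n-k}b^k$ with $C_k=\frac{1}{k+1}\binom{2k}{k}$; $S_n=S_n(1,1)$ and $S_n^{(r)}=S_n(1,r-1)$. $\delta_{n,0}=1$ if $n=0$ and $0$ otherwise. -}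

module Defs where

open import Data.Nat using (ℕ; zero; suc; _+_; _*_; _∸_; _≡ᵇ_)
open import Data.Nat.Combinatorics using (_C_)
open import Data.Nat.DivMod using (_/_)
open import Data.Fin using (Fin)
open import Data.Fin.Properties using (_≟_)
open import Data.Bool using (Bool; true; false; _∧_; not; if_then_else_)
open import Data.List using (List; []; _∷_; [_]; map; concatMap; upTo; length)
open import Data.Nat.ListAction using (sum)
open import Data.Fin.Base using () renaming (toℕ to finToℕ)
open import Data.List using (allFin)
open import Relation.Nullary.Decidable using (⌊_⌋)
open import Data.Integer using (ℤ; +_) renaming (_+_ to _+ℤ_; _*_ to _*ℤ_; _^_ to _^ℤ_)

data Step (r : ℕ) : Set where
  u : Step r
  d : Fin r → Step r

words : (r m : ℕ) → List (List (Step r))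
words r zero    = [ [] ]
words r (suc m) = concatMap (λ w → map (λ s → s ∷ w) (u ∷ map d (allFin r))) (words r m)

dyckFrom : {r : ℕ} → ℕ → List (Step r) → Bool
dyckFrom h []            = h ≡ᵇ 0
dyckFrom h (u ∷ s)       = dyckFrom (suc h) s
dyckFrom zero (d _ ∷ s)  = false
dyckFrom (suc h) (d _ ∷ s) = dyckFrom h s

isDyck : {r : ℕ} → List (Step r) → Bool
isDyck = dyckFrom 0

noSameDD : {r : ℕ} → List (Step r) → Bool
noSameDD []                    = true
noSameDD (u ∷ s)               = noSameDD s
noSameDD (d c ∷ [])            = true
noSameDD (d c ∷ u ∷ s)         = noSameDD s
noSameDD (d c ∷ d c' ∷ s)      = not ⌊ c ≟ c' ⌋ ∧ noSameDD (d c' ∷ s)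

filterB : {A : Set} → (A → Bool) → List A → List A
filterB p []       = []
filterB p (x ∷ xs) = if p x then x ∷ filterB p xs else filterB p xs

A0 : (r n : ℕ) → List (List (Step r))
A0 r n = filterB (λ w → isDyck w ∧ noSameDD w) (words r (2 * n))

-- Number of peaks (u immediately followed by d) whose common point has
-- ordinate `lev`, for a path starting at height h.
peaksFrom : {r : ℕ} → (lev h : ℕ) → List (Step r) → ℕ
peaksFrom lev h []                = 0
peaksFrom lev h (u ∷ [])          = 0
peaksFrom lev h (u ∷ u ∷ s)       = peaksFrom lev (suc h) (u ∷ s)
peaksFrom lev h (u ∷ d c ∷ s)     = (if suc h ≡ᵇ lev then 1 else 0) + peaksFrom lev (suc h) (d c ∷ s)
peaksFrom lev h (d c ∷ s)         = peaksFrom lev (h ∸ 1) s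

peaksAtLevel : {r : ℕ} → ℕ → List (Step r) → ℕ
peaksAtLevel lev = peaksFrom lev 0

p : (r n ℓ : ℕ) → ℕ
p r n ℓ = sum (map (peaksAtLevel (suc ℓ)) (A0 r (suc n)))

catalan : ℕ → ℕ
catalan k = ((2 * k) C k) / suc k

Σℤ : ℕ → (ℕ → ℤ) → ℤ
Σℤ n f = Data.List.foldr _+ℤ_ (+ 0) (map f (upTo (suc n)))

S : ℤ → ℤ → ℕ → ℤ
S a b n = Σℤ n (λ k → (+ (((n + k) C (2 * k)) * catalan k)) *ℤ ((a ^ℤ (n ∸ k)) *ℤ (b ^ℤ k)))

Sr : ℕ → ℕ → ℤ
Sr r n = S (+ 1) (+ (r ∸ 1)) n

Schröder : ℕ → ℤ
Schröder n = S (+ 1) (+ 1) n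

δ0 : ℕ → ℤ
δ0 zero    = + 1
δ0 (suc _) = + 0

{-# OPTIONS --safe #-}
-- Write b = r - 1 and A(z) = Σ S⁽ʳ⁾ₙ zⁿ, so that A = 1 + z(A + bA²).  Splitting a path
-- after its first step gives generating series for the paths of 𝒜⁽ʳ⁾ from any height
-- and for their peaks at a fixed level; this yields p⁽ʳ⁾ₙ,ₗ = r bˡ [zⁿ⁻ˡ] A²ˡ⁺².
-- Hence Σₗ (-1)ˡ p⁽ʳ⁾ₙ,ₗ aₗ = r [zⁿ] A² a(w) with w = -b z A², for every sequence a.
-- For a = A, V = A(w) satisfies V = 1 + w(V + bV²), so A V solves
-- Y = 1 + z(Y - b²Y²), the equation of Y(z) = Σ Sₙ(1, -b²) zⁿ = Σ (-1)ⁿ Sₙ(-1, b²) zⁿ;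
-- this gives the first identity, and V = Y - zY - b z A Y gives the second.  For r = 2,
-- Y = 1.  The substitution a(w) is never formed: Aᵏ · (Aʲ)(w) is a family indexed by k
-- and j, and, like the powers of a solution of F = 1 + z(αF + βF²), it satisfies a
-- linear recurrence P(k+1) = P(k) + z(α P(k+1) + β P(k+2)) that determines it from P(0).

module Submission where

open import Data.Nat using (ℕ)
open import Data.Integer using (ℤ)

module PowerSeries where

  open import Data.Nat as ℕ using (ℕ; zero; suc; _∸_; _≤_; _<_; z≤n; s≤s)
  open import Data.Nat.Properties as ℕ using ()
  open import Data.Nat.Induction using (<-rec)
  open import Data.Integer as ℤ using (ℤ; +_; -_; _+_; _*_)
  open import Data.Integer.Properties as ℤ using ()
  open import Data.Integer.Tactic.RingSolver using (solve-∀)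
  open import Data.Maybe using (Maybe; just; nothing)
  open import Data.Product using (_,_)
  open import Function using (_∘_)
  open import Relation.Binary.PropositionalEquality
  open import Relation.Binary.Structures using (IsEquivalence)
  open import Relation.Nullary using (yes; no)
  open import Algebra.Structures using (IsCommutativeMonoid)
  open import Algebra.Structures.Biased using (isCommutativeSemiringˡ)
  open import Algebra.Solver.Ring.AlmostCommutativeRing
    using (AlmostCommutativeRing; _-Raw-AlmostCommutative⟶_)
  import Algebra.Solver.Ring

  sum≤ : ℕ → (ℕ → ℤ) → ℤ
  sum≤ zero    f = f 0
  sum≤ (suc n) f = f 0 + sum≤ n (f ∘ suc)

  sum≤-cong-≤ : ∀ n {f g : ℕ → ℤ} → (∀ i → i ≤ n → f i ≡ g i) → sum≤ n f ≡ sum≤ n g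
  sum≤-cong-≤ zero    e = e 0 z≤n
  sum≤-cong-≤ (suc n) e = cong₂ _+_ (e 0 z≤n) (sum≤-cong-≤ n (λ i i≤n → e (suc i) (s≤s i≤n)))

  sum≤-cong : ∀ n {f g : ℕ → ℤ} → (∀ i → f i ≡ g i) → sum≤ n f ≡ sum≤ n g
  sum≤-cong n e = sum≤-cong-≤ n (λ i _ → e i)

  sum≤-zero : ∀ n (f : ℕ → ℤ) → (∀ i → i ≤ n → f i ≡ + 0) → sum≤ n f ≡ + 0
  sum≤-zero n f e = trans (sum≤-cong-≤ n {g = λ _ → + 0} e) (sum≤-const-zero n)
    where
    sum≤-const-zero : ∀ n → sum≤ n (λ _ → + 0) ≡ + 0
    sum≤-const-zero zero    = refl
    sum≤-const-zero (suc n) = cong (_+_ (+ 0)) (sum≤-const-zero n)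

  sum≤-distrib-+ : ∀ n (f g : ℕ → ℤ) → sum≤ n (λ i → f i + g i) ≡ sum≤ n f + sum≤ n g
  sum≤-distrib-+ zero    f g = refl
  sum≤-distrib-+ (suc n) f g =
    trans (cong (_+_ (f 0 + g 0)) (sum≤-distrib-+ n (f ∘ suc) (g ∘ suc)))
          (interchange (f 0) (g 0) (sum≤ n (f ∘ suc)) (sum≤ n (g ∘ suc)))
    where
    interchange : ∀ a b c d → (a + b) + (c + d) ≡ (a + c) + (b + d)
    interchange = solve-∀

  sum≤-*ˡ : ∀ n c (f : ℕ → ℤ) → sum≤ n (λ i → c * f i) ≡ c * sum≤ n f
  sum≤-*ˡ zero    c f = refl
  sum≤-*ˡ (suc n) c f =
    trans (cong (_+_ (c * f 0)) (sum≤-*ˡ n c (f ∘ suc))) (sym (ℤ.*-distribˡ-+ c (f 0) _))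

  sum≤-neg : ∀ n (f : ℕ → ℤ) → sum≤ n (λ i → - f i) ≡ - sum≤ n f
  sum≤-neg zero    f = refl
  sum≤-neg (suc n) f =
    trans (cong (_+_ (- f 0)) (sum≤-neg n (f ∘ suc))) (sym (ℤ.neg-distrib-+ (f 0) _))

  sum≤-suc : ∀ n (f : ℕ → ℤ) → sum≤ (suc n) f ≡ sum≤ n f + f (suc n)
  sum≤-suc zero    f = refl
  sum≤-suc (suc n) f =
    trans (cong (_+_ (f 0)) (sum≤-suc n (f ∘ suc))) (sym (ℤ.+-assoc (f 0) _ _))

  sum≤-suc-vanishing : ∀ n (f : ℕ → ℤ) → f (suc n) ≡ + 0 → sum≤ (suc n) f ≡ sum≤ n f
  sum≤-suc-vanishing n f e = trans (sum≤-suc n f) (trans (cong (_+_ (sum≤ n f)) e) (ℤ.+-identityʳ _))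

  sum≤-linear : ∀ n a c (f g : ℕ → ℤ) →
    sum≤ n (λ i → a * f i + c * g i) ≡ a * sum≤ n f + c * sum≤ n g
  sum≤-linear n a c f g =
    trans (sum≤-distrib-+ n (λ i → a * f i) (λ i → c * g i))
          (cong₂ _+_ (sum≤-*ˡ n a f) (sum≤-*ˡ n c g))

  Series : Set
  Series = ℕ → ℤ

  infix  4 _≈_
  infixl 6 _⊕_
  infixl 7 _⊛_
  infix  8 ⊝_

  _≈_ : Series → Series → Set
  f ≈ g = ∀ n → f n ≡ g n

  _⊕_ : Series → Series → Series
  (f ⊕ g) n = f n + g n

  ⊝_ : Series → Series
  (⊝ f) n = - f n

  _⊛_ : Series → Series → Series
  (f ⊛ g) n = sum≤ n (λ i → f i * g (n ∸ i))

  const : ℤ → Series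
  const c zero    = c
  const c (suc _) = + 0

  𝟎 𝟏 : Series
  𝟎 _ = + 0
  𝟏   = const (+ 1)

  z : Series
  z 1 = + 1
  z _ = + 0

  tail : Series → Series
  tail f n = f (suc n)

  scale : ℤ → Series → Series
  scale c f n = c * f n

  ≈-refl : ∀ {f} → f ≈ f
  ≈-refl _ = refl

  ≈-sym : ∀ {f g} → f ≈ g → g ≈ f
  ≈-sym e n = sym (e n)

  ≈-trans : ∀ {f g h} → f ≈ g → g ≈ h → f ≈ h
  ≈-trans e e′ n = trans (e n) (e′ n)

  ≈-isEquivalence : IsEquivalence _≈_
  ≈-isEquivalence = record { refl = ≈-refl ; sym = ≈-sym ; trans = ≈-trans }

  ⊕-cong : ∀ {f f′ g g′} → f ≈ f′ → g ≈ g′ → f ⊕ g ≈ f′ ⊕ g′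
  ⊕-cong e e′ n = cong₂ _+_ (e n) (e′ n)

  ⊝-cong : ∀ {f f′} → f ≈ f′ → ⊝ f ≈ ⊝ f′
  ⊝-cong e n = cong -_ (e n)

  ⊛-cong : ∀ {f f′ g g′} → f ≈ f′ → g ≈ g′ → f ⊛ g ≈ f′ ⊛ g′
  ⊛-cong e e′ n = sum≤-cong n (λ i → cong₂ _*_ (e i) (e′ (n ∸ i)))

  ⊛-congˡ : ∀ {f f′} g → f ≈ f′ → f ⊛ g ≈ f′ ⊛ g
  ⊛-congˡ g e = ⊛-cong e (≈-refl {g})

  ⊛-congʳ : ∀ f {g g′} → g ≈ g′ → f ⊛ g ≈ f ⊛ g′
  ⊛-congʳ f e = ⊛-cong (≈-refl {f}) e

  ⊛-cong-≤ : ∀ f {g g′} n → (∀ j → j ≤ n → g j ≡ g′ j) → (f ⊛ g) n ≡ (f ⊛ g′) n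
  ⊛-cong-≤ f n e = sum≤-cong n (λ i → cong (f i *_) (e (n ∸ i) (ℕ.m∸n≤m n i)))

  ⊛-distribʳ : ∀ f g h → (f ⊕ g) ⊛ h ≈ f ⊛ h ⊕ g ⊛ h
  ⊛-distribʳ f g h n =
    trans (sum≤-cong n (λ i → ℤ.*-distribʳ-+ (h (n ∸ i)) (f i) (g i))) (sum≤-distrib-+ n _ _)

  scale-⊛ : ∀ c f g → scale c f ⊛ g ≈ scale c (f ⊛ g)
  scale-⊛ c f g n = trans (sum≤-cong n (λ i → ℤ.*-assoc c (f i) (g (n ∸ i)))) (sum≤-*ˡ n c _)

  ⊛-zeroˡ : ∀ f → 𝟎 ⊛ f ≈ 𝟎
  ⊛-zeroˡ f n = sum≤-zero n _ (λ _ _ → refl)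

  ⊛-identityˡ : ∀ f → 𝟏 ⊛ f ≈ f
  ⊛-identityˡ f zero    = ℤ.*-identityˡ (f 0)
  ⊛-identityˡ f (suc n) =
    trans (cong₂ _+_ (ℤ.*-identityˡ (f (suc n))) (sum≤-zero n _ (λ _ _ → refl)))
          (ℤ.+-identityʳ _)

  ⊛-comm : ∀ f g → f ⊛ g ≈ g ⊛ f
  ⊛-comm f g zero          = ℤ.*-comm (f 0) (g 0)
  ⊛-comm f g (suc zero)    = swap (f 0) (g 1) (f 1) (g 0)
    where
    swap : ∀ a b c d → a * b + (c * d) ≡ d * c + b * a
    swap = solve-∀
  ⊛-comm f g (suc (suc n)) =
    begin
      f 0 * g (suc (suc n)) + (tail f ⊛ g) (suc n)
    ≡⟨ cong (_+_ (f 0 * g (suc (suc n)))) (⊛-comm (tail f) g (suc n)) ⟩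
      f 0 * g (suc (suc n)) + (g 0 * f (suc (suc n)) + (tail g ⊛ tail f) n)
    ≡⟨ cong (λ t → f 0 * g (suc (suc n)) + (g 0 * f (suc (suc n)) + t)) (⊛-comm (tail g) (tail f) n) ⟩
      f 0 * g (suc (suc n)) + (g 0 * f (suc (suc n)) + (tail f ⊛ tail g) n)
    ≡⟨ exchange (f 0) (g (suc (suc n))) (g 0) (f (suc (suc n))) ((tail f ⊛ tail g) n) ⟩
      g 0 * f (suc (suc n)) + (f 0 * g (suc (suc n)) + (tail f ⊛ tail g) n)
    ≡⟨ cong (_+_ (g 0 * f (suc (suc n)))) (⊛-comm (tail g) f (suc n)) ⟨
      g 0 * f (suc (suc n)) + (tail g ⊛ f) (suc n)
    ∎
    where
    open ≡-Reasoning
    exchange : ∀ a b c d e → a * b + (c * d + e) ≡ c * d + (a * b + e)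
    exchange = solve-∀

  -- Definitionally, tail (f ⊛ g) n ≡ f 0 * tail g n + (tail f ⊛ g) n.
  ⊛-assoc : ∀ f g h → (f ⊛ g) ⊛ h ≈ f ⊛ (g ⊛ h)
  ⊛-assoc f g h zero    = ℤ.*-assoc (f 0) (g 0) (h 0)
  ⊛-assoc f g h (suc n) =
    trans (cong (_+_ (f 0 * g 0 * h (suc n)))
            (trans (⊛-distribʳ (scale (f 0) (tail g)) (tail f ⊛ g) h n)
                   (cong₂ _+_ (scale-⊛ (f 0) (tail g) h n) (⊛-assoc (tail f) g h n))))
          (regroup (f 0) (g 0) (h (suc n)) ((tail g ⊛ h) n) ((tail f ⊛ (g ⊛ h)) n))
    where
    regroup : ∀ a b c x y → a * b * c + (a * x + y) ≡ a * (b * c + x) + y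
    regroup = solve-∀

  ⊛-identityʳ : ∀ f → f ⊛ 𝟏 ≈ f
  ⊛-identityʳ f n = trans (⊛-comm f 𝟏 n) (⊛-identityˡ f n)

  ⊛-zeroʳ : ∀ f → f ⊛ 𝟎 ≈ 𝟎
  ⊛-zeroʳ f n = trans (⊛-comm f 𝟎 n) (⊛-zeroˡ f n)

  ⊕-isCommutativeMonoid : IsCommutativeMonoid _≈_ _⊕_ 𝟎
  ⊕-isCommutativeMonoid = record
    { isMonoid = record
      { isSemigroup = record
        { isMagma = record { isEquivalence = ≈-isEquivalence ; ∙-cong = ⊕-cong }
        ; assoc   = λ f g h n → ℤ.+-assoc (f n) (g n) (h n) }
      ; identity = (λ f n → ℤ.+-identityˡ (f n)) , (λ f n → ℤ.+-identityʳ (f n)) }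
    ; comm = λ f g n → ℤ.+-comm (f n) (g n) }

  ⊛-isCommutativeMonoid : IsCommutativeMonoid _≈_ _⊛_ 𝟏
  ⊛-isCommutativeMonoid = record
    { isMonoid = record
      { isSemigroup = record
        { isMagma = record { isEquivalence = ≈-isEquivalence ; ∙-cong = ⊛-cong }
        ; assoc   = ⊛-assoc }
      ; identity = ⊛-identityˡ , ⊛-identityʳ }
    ; comm = ⊛-comm }

  seriesRing : AlmostCommutativeRing _ _
  seriesRing = record
    { Carrier = Series ; _≈_ = _≈_ ; _+_ = _⊕_ ; _*_ = _⊛_ ; -_ = ⊝_ ; 0# = 𝟎 ; 1# = 𝟏
    ; isAlmostCommutativeRing = record
      { isCommutativeSemiring = isCommutativeSemiringˡ (record
          { +-isCommutativeMonoid = ⊕-isCommutativeMonoid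
          ; *-isCommutativeMonoid = ⊛-isCommutativeMonoid
          ; distribʳ = λ h f g → ⊛-distribʳ f g h
          ; zeroˡ    = ⊛-zeroˡ })
      ; -‿cong       = ⊝-cong
      ; -‿*-distribˡ = λ f g n →
          trans (sum≤-cong n (λ i → sym (ℤ.neg-distribˡ-* (f i) (g (n ∸ i))))) (sum≤-neg n _)
      ; -‿+-comm     = λ f g n → sym (ℤ.neg-distrib-+ (f n) (g n))
      } }

  const-⊛-const : ∀ c d → const (c * d) ≈ const c ⊛ const d
  const-⊛-const c d zero    = refl
  const-⊛-const c d (suc n) =
    sym (cong₂ _+_ (ℤ.*-zeroʳ c) (sum≤-zero n _ (λ _ _ → refl)))

  const-morphism : ℤ.+-*-rawRing -Raw-AlmostCommutative⟶ seriesRing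
  const-morphism = record
    { ⟦_⟧    = const
    ; +-homo = λ { c d zero → refl ; c d (suc n) → refl }
    ; *-homo = const-⊛-const
    ; -‿homo = λ { c zero → refl ; c (suc n) → refl }
    ; 0-homo = λ { zero → refl ; (suc n) → refl }
    ; 1-homo = λ { zero → refl ; (suc n) → refl } }

  const≟ : ∀ c d → Maybe (const c ≈ const d)
  const≟ c d with c ℤ.≟ d
  ... | yes refl = just ≈-refl
  ... | no _     = nothing

  open Algebra.Solver.Ring ℤ.+-*-rawRing seriesRing const-morphism const≟ public
    using (solve; _:=_; _:+_; _:*_; :-_; con)

  const-⊛ : ∀ c f n → (const c ⊛ f) n ≡ c * f n
  const-⊛ c f zero    = refl
  const-⊛ c f (suc n) =
    trans (cong (_+_ (c * f (suc n))) (sum≤-zero n _ (λ _ _ → refl))) (ℤ.+-identityʳ _)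

  const-neg : ∀ c → const (- c) ≈ ⊝ const c
  const-neg c zero    = refl
  const-neg c (suc n) = refl

  z⊛-suc : ∀ f n → (z ⊛ f) (suc n) ≡ f n
  z⊛-suc f n = trans (ℤ.+-identityˡ _) (trans (⊛-congˡ f tail-z n) (⊛-identityˡ f n))
    where
    tail-z : tail z ≈ 𝟏
    tail-z zero    = refl
    tail-z (suc n) = refl

  infixr 8 _^ₛ_

  _^ₛ_ : Series → ℕ → Series
  f ^ₛ zero  = 𝟏
  f ^ₛ suc m = f ⊛ f ^ₛ m

  ^ₛ-≡ : ∀ f {m m′} → m ≡ m′ → f ^ₛ m ≈ f ^ₛ m′
  ^ₛ-≡ f refl = ≈-refl

  const-^ₛ : ∀ c m → const c ^ₛ m ≈ const (c ℤ.^ m)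
  const-^ₛ c zero    = ≈-refl
  const-^ₛ c (suc m) = ≈-trans (⊛-congʳ (const c) (const-^ₛ c m)) (≈-sym (const-⊛-const c (c ℤ.^ m)))

  z^ₛ⊛-low : ∀ ℓ f i → i < ℓ → (z ^ₛ ℓ ⊛ f) i ≡ + 0
  z^ₛ⊛-low (suc ℓ) f zero    _        = ⊛-assoc z (z ^ₛ ℓ) f 0
  z^ₛ⊛-low (suc ℓ) f (suc i) (s≤s i<ℓ) =
    trans (⊛-assoc z (z ^ₛ ℓ) f (suc i))
          (trans (z⊛-suc (z ^ₛ ℓ ⊛ f) i) (z^ₛ⊛-low ℓ f i i<ℓ))

  difference-≈𝟎 : ∀ {f g} → f ≈ g → f ⊕ ⊝ g ≈ 𝟎
  difference-≈𝟎 {f} e n = trans (cong (λ t → f n + - t) (sym (e n))) (ℤ.+-inverseʳ (f n))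

  difference-≈𝟎⇒≈ : ∀ f g → f ⊕ ⊝ g ≈ 𝟎 → f ≈ g
  difference-≈𝟎⇒≈ f g e n =
    begin
      f n                   ≡⟨ ℤ.+-identityʳ (f n) ⟨
      f n + + 0             ≡⟨ cong (_+_ (f n)) (ℤ.+-inverseˡ (g n)) ⟨
      f n + (- g n + g n)   ≡⟨ ℤ.+-assoc (f n) (- g n) (g n) ⟨
      f n + - g n + g n     ≡⟨ cong (_+ g n) (e n) ⟩
      + 0 + g n             ≡⟨ ℤ.+-identityˡ (g n) ⟩
      g n
    ∎
    where open ≡-Reasoning

  ⊛-vanishing : ∀ f g n → (∀ j → j ≤ n → g j ≡ + 0) → (f ⊛ g) n ≡ + 0
  ⊛-vanishing f g n e = trans (⊛-cong-≤ f n e) (⊛-zeroʳ f n)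

  ≈z⊛⇒≈𝟎 : ∀ f m → f ≈ z ⊛ (m ⊛ f) → f ≈ 𝟎
  ≈z⊛⇒≈𝟎 f m e = <-rec (λ n → f n ≡ + 0) step
    where
    step : ∀ n → (∀ {j} → j < n → f j ≡ + 0) → f n ≡ + 0
    step zero    _  = e 0
    step (suc n) ih =
      trans (e (suc n))
            (trans (z⊛-suc (m ⊛ f) n) (⊛-vanishing m f n (λ j j≤n → ih (s≤s j≤n))))

  ⊛-cancelˡ-1+z : ∀ a m f → a ≈ 𝟏 ⊕ z ⊛ m → a ⊛ f ≈ 𝟎 → f ≈ 𝟎
  ⊛-cancelˡ-1+z a m f a≈ af≈𝟎 = ≈z⊛⇒≈𝟎 f (⊝ m) (≈-trans (≈-sym f≈) (expand f m z))
    where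
    f≈ : f ⊕ ⊝ ((𝟏 ⊕ z ⊛ m) ⊛ f) ≈ f
    f≈ = ≈-trans (⊕-cong (≈-refl {f}) (⊝-cong (≈-trans (⊛-congˡ f (≈-sym a≈)) af≈𝟎)))
                 (λ n → ℤ.+-identityʳ (f n))
    expand : ∀ f m z → f ⊕ ⊝ ((𝟏 ⊕ z ⊛ m) ⊛ f) ≈ z ⊛ (⊝ m ⊛ f)
    expand = solve 3 (λ f m z → f :+ :- ((con (+ 1) :+ z :* m) :* f) := z :* (:- m :* f)) ≈-refl

  Recurrence : Series → Series → (ℕ → Series) → Set
  Recurrence α β P = ∀ k → P (suc k) ≈ P k ⊕ z ⊛ (α ⊛ P (suc k) ⊕ β ⊛ P (suc (suc k)))

  recurrence-≈𝟎 : ∀ {α β P} → Recurrence α β P → P 0 ≈ 𝟎 → ∀ k → P k ≈ 𝟎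
  recurrence-≈𝟎 {α} {β} {P} rec P0≈𝟎 k n = <-rec (λ n → ∀ k → P k n ≡ + 0) step n k
    where
    step : ∀ n → (∀ {j} → j < n → ∀ k → P k j ≡ + 0) → ∀ k → P k n ≡ + 0
    step n       ih zero    = P0≈𝟎 n
    step zero    ih (suc k) = trans (rec k 0) (trans (ℤ.+-identityʳ _) (step 0 ih k))
    step (suc n) ih (suc k) =
      trans (rec k (suc n))
            (cong₂ _+_ (step (suc n) ih k)
                       (trans (z⊛-suc (α ⊛ P (suc k) ⊕ β ⊛ P (suc (suc k))) n)
                              (cong₂ _+_ (⊛-vanishing α (P (suc k)) n low)
                                         (⊛-vanishing β (P (suc (suc k))) n low))))
      where
      low : ∀ {k} j → j ≤ n → P k j ≡ + 0
      low {k} j j≤n = ih (s≤s j≤n) k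

  recurrence-factor : ∀ {α β P Q} → Recurrence α β P → Recurrence α β Q → Q 0 ≈ 𝟏 →
                      ∀ k → P k ≈ Q k ⊛ P 0
  recurrence-factor {α} {β} {P} {Q} recP recQ Q0≈𝟏 k =
    difference-≈𝟎⇒≈ (P k) (Q k ⊛ P 0) (recurrence-≈𝟎 {α} {β} {D} recD D0≈𝟎 k)
    where
    D : ℕ → Series
    D k = P k ⊕ ⊝ (Q k ⊛ P 0)
    D0≈𝟎 : D 0 ≈ 𝟎
    D0≈𝟎 = difference-≈𝟎 (≈-sym (≈-trans (⊛-congˡ (P 0) Q0≈𝟏) (⊛-identityˡ (P 0))))
    linear : ∀ p₀ p₁ p₂ q₀ q₁ q₂ c z α β →
      (p₀ ⊕ z ⊛ (α ⊛ p₁ ⊕ β ⊛ p₂)) ⊕ ⊝ ((q₀ ⊕ z ⊛ (α ⊛ q₁ ⊕ β ⊛ q₂)) ⊛ c)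
        ≈ (p₀ ⊕ ⊝ (q₀ ⊛ c)) ⊕ z ⊛ (α ⊛ (p₁ ⊕ ⊝ (q₁ ⊛ c)) ⊕ β ⊛ (p₂ ⊕ ⊝ (q₂ ⊛ c)))
    linear = solve 10 (λ p₀ p₁ p₂ q₀ q₁ q₂ c z α β →
      (p₀ :+ z :* (α :* p₁ :+ β :* p₂)) :+ :- ((q₀ :+ z :* (α :* q₁ :+ β :* q₂)) :* c)
        := (p₀ :+ :- (q₀ :* c)) :+ z :* (α :* (p₁ :+ :- (q₁ :* c)) :+ β :* (p₂ :+ :- (q₂ :* c))))
      ≈-refl
    recD : Recurrence α β D
    recD k = ≈-trans (⊕-cong (recP k) (⊝-cong (⊛-congˡ (P 0) (recQ k))))
                     (linear (P k) (P (suc k)) (P (suc (suc k))) (Q k) (Q (suc k)) (Q (suc (suc k)))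
                             (P 0) z α β)

  recurrence-square : ∀ {α β P} → Recurrence α β P → P 0 ≈ 𝟏 → P 2 ≈ P 1 ⊛ P 1
  recurrence-square {α} {β} {P} rec P0≈𝟏 =
    recurrence-factor {α} {β} {P ∘ suc} {P} (rec ∘ suc) rec P0≈𝟏 1

  z-step-suc : ∀ f a g c h n →
    (f ⊕ z ⊛ (const a ⊛ g ⊕ const c ⊛ h)) (suc n) ≡ f (suc n) + (a * g n + c * h n)
  z-step-suc f a g c h n =
    cong (_+_ (f (suc n)))
         (trans (z⊛-suc (const a ⊛ g ⊕ const c ⊛ h) n) (cong₂ _+_ (const-⊛ a g n) (const-⊛ c h n)))

  recurrence-coeff-zero : ∀ {a c P} → Recurrence (const a) (const c) P → ∀ k → P (suc k) 0 ≡ P k 0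
  recurrence-coeff-zero rec k = trans (rec k 0) (ℤ.+-identityʳ _)

  recurrence-coeff-suc : ∀ {a c P} → Recurrence (const a) (const c) P → ∀ k n →
    P (suc k) (suc n) ≡ P k (suc n) + (a * P (suc k) n + c * P (suc (suc k)) n)
  recurrence-coeff-suc {a} {c} {P} rec k n =
    trans (rec k (suc n)) (z-step-suc (P k) a (P (suc k)) c (P (suc (suc k))) n)

  recurrence-from-coeffs : ∀ {a c P} →
    (∀ k → P (suc k) 0 ≡ P k 0) →
    (∀ k n → P (suc k) (suc n) ≡ P k (suc n) + (a * P (suc k) n + c * P (suc (suc k)) n)) →
    Recurrence (const a) (const c) P
  recurrence-from-coeffs at-zero at-suc k zero    = trans (at-zero k) (sym (ℤ.+-identityʳ _))
  recurrence-from-coeffs {a} {c} {P} at-zero at-suc k (suc n) =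
    trans (at-suc k n) (sym (z-step-suc (P k) a (P (suc k)) c (P (suc (suc k))) n))

  recurrence-⊛ : ∀ {α β P} c → Recurrence α β P → Recurrence α β (λ k → c ⊛ P k)
  recurrence-⊛ {α} {β} {P} c rec k =
    ≈-trans (⊛-congʳ c (rec k)) (distribute c (P k) (P (suc k)) (P (suc (suc k))) z α β)
    where
    distribute : ∀ c p₀ p₁ p₂ z α β →
      c ⊛ (p₀ ⊕ z ⊛ (α ⊛ p₁ ⊕ β ⊛ p₂)) ≈ c ⊛ p₀ ⊕ z ⊛ (α ⊛ (c ⊛ p₁) ⊕ β ⊛ (c ⊛ p₂))
    distribute = solve 7 (λ c p₀ p₁ p₂ z α β →
      c :* (p₀ :+ z :* (α :* p₁ :+ β :* p₂)) := c :* p₀ :+ z :* (α :* (c :* p₁) :+ β :* (c :* p₂)))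
      ≈-refl

  recurrence-shift : ∀ {α β P} d → Recurrence α β P → Recurrence α β (λ k → P (d ℕ.+ k))
  recurrence-shift {P = P} d rec k rewrite ℕ.+-suc d (suc k) | ℕ.+-suc d k = rec (d ℕ.+ k)

  quadratic-unique : ∀ α β f g →
    f ≈ 𝟏 ⊕ z ⊛ (α ⊛ f ⊕ β ⊛ (f ⊛ f)) → g ≈ 𝟏 ⊕ z ⊛ (α ⊛ g ⊕ β ⊛ (g ⊛ g)) → f ≈ g
  quadratic-unique α β f g f≈ g≈ =
    difference-≈𝟎⇒≈ f g
      (≈z⊛⇒≈𝟎 (f ⊕ ⊝ g) (α ⊕ β ⊛ (f ⊕ g)) (≈-trans (⊕-cong f≈ (⊝-cong g≈)) (factor f g z α β)))
    where
    factor : ∀ f g z α β →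
      (𝟏 ⊕ z ⊛ (α ⊛ f ⊕ β ⊛ (f ⊛ f))) ⊕ ⊝ (𝟏 ⊕ z ⊛ (α ⊛ g ⊕ β ⊛ (g ⊛ g)))
        ≈ z ⊛ ((α ⊕ β ⊛ (f ⊕ g)) ⊛ (f ⊕ ⊝ g))
    factor = solve 5 (λ f g z α β →
      (con (+ 1) :+ z :* (α :* f :+ β :* (f :* f))) :+ :- (con (+ 1) :+ z :* (α :* g :+ β :* (g :* g)))
        := z :* ((α :+ β :* (f :+ g)) :* (f :+ :- g)))
      ≈-refl

  ≈-modulo : ∀ f g m e → f ⊕ ⊝ g ≈ m ⊛ e → e ≈ 𝟎 → f ≈ g
  ≈-modulo f g m e f-g≈ e≈𝟎 =
    difference-≈𝟎⇒≈ f g (≈-trans f-g≈ (≈-trans (⊛-congʳ m e≈𝟎) (⊛-zeroʳ m)))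

  ≈-modulo₂ : ∀ f g m e m′ e′ → f ⊕ ⊝ g ≈ m ⊛ e ⊕ m′ ⊛ e′ → e ≈ 𝟎 → e′ ≈ 𝟎 → f ≈ g
  ≈-modulo₂ f g m e m′ e′ f-g≈ e≈𝟎 e′≈𝟎 =
    difference-≈𝟎⇒≈ f g
      (≈-trans f-g≈ (≈-trans (⊕-cong (≈-trans (⊛-congʳ m e≈𝟎) (⊛-zeroʳ m))
                                     (≈-trans (⊛-congʳ m′ e′≈𝟎) (⊛-zeroʳ m′)))
                             (λ _ → refl)))

module Ballot where

  open import Data.Nat
  open import Data.Nat.Properties
  open import Data.Nat.Combinatorics
  open import Data.Nat.Combinatorics.Specification using (nCk≡n!/k![n-k]!)
  open import Data.Nat.DivMod using (_/_; m/n*n≡m; m*n/n≡m)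
  open import Data.Nat.Tactic.RingSolver using (solve-∀)
  open import Relation.Binary.PropositionalEquality
  open import Defs using (catalan)

  -- ballot k m is the coefficient of tᵏ in C(t)ᵐ, C the Catalan series; the
  -- recursion is C(t)ᵐ⁺¹ = C(t)ᵐ + t C(t)ᵐ⁺².
  ballot : ℕ → ℕ → ℕ
  ballot zero    m       = 1
  ballot (suc k) zero    = 0
  ballot (suc k) (suc m) = ballot (suc k) m + ballot k (suc (suc m))

  pascal : ∀ n k → suc n C suc k ≡ n C k + n C suc k
  pascal n k = sym (nCk+nC[k+1]≡[n+1]C[k+1] n k)

  ballot-binomial : ∀ j m →
    ballot (suc j) (suc m) + (suc j + suc j + m) C j ≡ (suc j + suc j + m) C suc j
  ballot-binomial zero    zero    = refl
  ballot-binomial (suc i) zero    =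
    begin
      ballot (suc i) 2 + (suc (suc i) + suc (suc i) + 0) C suc i
    ≡⟨ cong (λ x → ballot (suc i) 2 + x C suc i) (2[i+2]≡1+M i) ⟩
      ballot (suc i) 2 + suc M C suc i
    ≡⟨ cong (ballot (suc i) 2 +_) (pascal M i) ⟩
      ballot (suc i) 2 + (M C i + M C suc i)
    ≡⟨ +-assoc (ballot (suc i) 2) _ _ ⟨
      ballot (suc i) 2 + M C i + M C suc i
    ≡⟨ cong (_+ M C suc i) (ballot-binomial i 1) ⟩
      M C suc i + M C suc i
    ≡⟨ cong (λ x → M C suc i + M C x) M∸[i+2]≡i+1 ⟨
      M C suc i + M C (M ∸ suc (suc i))
    ≡⟨ cong (M C suc i +_) (nCk≡nC[n∸k] {suc (suc i)} {M} i+2≤M) ⟨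
      M C suc i + M C suc (suc i)
    ≡⟨ pascal M (suc i) ⟨
      suc M C suc (suc i)
    ≡⟨ cong (λ x → x C suc (suc i)) (2[i+2]≡1+M i) ⟨
      (suc (suc i) + suc (suc i) + 0) C suc (suc i)
    ∎
    where
    open ≡-Reasoning
    M = suc i + suc i + 1
    M≡[i+1]+[i+2] : ∀ i → suc i + suc i + 1 ≡ suc i + suc (suc i)
    M≡[i+1]+[i+2] = solve-∀
    2[i+2]≡1+M : ∀ i → suc (suc i) + suc (suc i) + 0 ≡ suc (suc i + suc i + 1)
    2[i+2]≡1+M = solve-∀
    i+2≤M : suc (suc i) ≤ M
    i+2≤M = subst (suc (suc i) ≤_) (sym (M≡[i+1]+[i+2] i)) (m≤n+m (suc (suc i)) (suc i))
    M∸[i+2]≡i+1 : M ∸ suc (suc i) ≡ suc i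
    M∸[i+2]≡i+1 = trans (cong (_∸ suc (suc i)) (M≡[i+1]+[i+2] i)) (m+n∸n≡m (suc i) (suc (suc i)))
  ballot-binomial zero    (suc m) =
    begin
      ballot 1 (suc m) + 1 + (2 + suc m) C 0
    ≡⟨ +-comm (ballot 1 (suc m) + 1) 1 ⟩
      1 + (ballot 1 (suc m) + 1)
    ≡⟨ cong (1 +_) (ballot-binomial zero m) ⟩
      1 + (2 + m) C 1
    ≡⟨ pascal (2 + m) 0 ⟨
      suc (2 + m) C 1
    ≡⟨ cong (_C 1) (+-suc 2 m) ⟨
      (2 + suc m) C 1
    ∎
    where open ≡-Reasoning
  ballot-binomial (suc i) (suc m) =
    begin
      ballot (suc j) (suc m) + ballot j (3 + m) + (suc j + suc j + suc m) C j
    ≡⟨ cong (λ x → ballot (suc j) (suc m) + ballot j (3 + m) + x C j) (+-suc (suc j + suc j) m) ⟩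
      ballot (suc j) (suc m) + ballot j (3 + m) + suc N C j
    ≡⟨ cong (ballot (suc j) (suc m) + ballot j (3 + m) +_) (pascal N i) ⟩
      ballot (suc j) (suc m) + ballot j (3 + m) + (N C i + N C j)
    ≡⟨ interchange (ballot (suc j) (suc m)) (ballot j (3 + m)) (N C i) (N C j) ⟩
      (ballot (suc j) (suc m) + N C j) + (ballot j (3 + m) + N C i)
    ≡⟨ cong₂ _+_ (ballot-binomial (suc i) m) lower ⟩
      N C suc j + N C j
    ≡⟨ +-comm (N C suc j) (N C j) ⟩
      N C j + N C suc j
    ≡⟨ pascal N j ⟨
      suc N C suc j
    ≡⟨ cong (_C suc j) (+-suc (suc j + suc j) m) ⟨
      (suc j + suc j + suc m) C suc j
    ∎
    where
    open ≡-Reasoning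
    j = suc i
    N = suc j + suc j + m
    2[i+1]+m+2≡N : ∀ i m → suc i + suc i + suc (suc m) ≡ suc (suc i) + suc (suc i) + m
    2[i+1]+m+2≡N = solve-∀
    lower : ballot j (3 + m) + N C i ≡ N C j
    lower = subst (λ x → ballot j (3 + m) + x C i ≡ x C j) (2[i+1]+m+2≡N i m)
                  (ballot-binomial i (suc (suc m)))
    interchange : ∀ a b c d → a + b + (c + d) ≡ (a + d) + (b + c)
    interchange = solve-∀

  binomial-factorials : ∀ {n k} → k ≤ n → (n C k) * (k ! * (n ∸ k) !) ≡ n !
  binomial-factorials {n} {k} k≤n =
    trans (cong (_* (k ! * (n ∸ k) !)) (nCk≡n!/k![n-k]! k≤n))
          (m/n*n≡m {{k !* (n ∸ k) !≢0}} (k![n∸k]!∣n! k≤n))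

  central-binomial-absorption : ∀ j →
    suc j * ((2 * suc j) C suc j) ≡ suc (suc j) * ((2 * suc j) C j)
  central-binomial-absorption j = *-cancelʳ-≡ _ _ (j ! * suc j !) {{j !* suc j !≢0}} eq
    where
    n = 2 * suc j
    C₁ = n C suc j
    C₀ = n C j
    n≡[j+1]+[j+1] : ∀ j → 2 * suc j ≡ suc j + suc j
    n≡[j+1]+[j+1] = solve-∀
    n≡j+[j+2] : ∀ j → 2 * suc j ≡ j + suc (suc j)
    n≡j+[j+2] = solve-∀
    C₁-factorials : C₁ * (suc j ! * suc j !) ≡ n !
    C₁-factorials =
      trans (cong (λ x → C₁ * (suc j ! * x !))
                  (sym (trans (cong (_∸ suc j) (n≡[j+1]+[j+1] j)) (m+n∸m≡n (suc j) (suc j)))))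
            (binomial-factorials (m≤m+n (suc j) (suc j + 0)))
    C₀-factorials : C₀ * (j ! * suc (suc j) !) ≡ n !
    C₀-factorials =
      trans (cong (λ x → C₀ * (j ! * x !))
                  (sym (trans (cong (_∸ j) (n≡j+[j+2] j)) (m+n∸m≡n j (suc (suc j))))))
            (binomial-factorials (≤-trans (n≤1+n j) (m≤m+n (suc j) (suc j + 0))))
    reassoc₁ : ∀ s C F₀ F₁ → suc s * C * (F₀ * F₁) ≡ C * ((suc s * F₀) * F₁)
    reassoc₁ = solve-∀
    reassoc₀ : ∀ s C F₀ F₁ → suc (suc s) * C * (F₀ * F₁) ≡ C * (F₀ * (suc (suc s) * F₁))
    reassoc₀ = solve-∀
    eq : suc j * C₁ * (j ! * suc j !) ≡ suc (suc j) * C₀ * (j ! * suc j !)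
    eq = trans (reassoc₁ j C₁ (j !) (suc j !))
               (trans C₁-factorials (trans (sym C₀-factorials) (sym (reassoc₀ j C₀ (j !) (suc j !)))))

  ballot-1≡catalan : ∀ k → ballot k 1 ≡ catalan k
  ballot-1≡catalan zero    = refl
  ballot-1≡catalan (suc j) =
    sym (trans (cong (_/ suc (suc j)) C₁≡ballot*[j+2]) (m*n/n≡m (ballot (suc j) 1) (suc (suc j))))
    where
    n = 2 * suc j
    C₁ = n C suc j
    C₀ = n C j
    ballot+C₀≡C₁ : ballot (suc j) 1 + C₀ ≡ C₁
    ballot+C₀≡C₁ = subst (λ x → ballot (suc j) 1 + x C j ≡ x C suc j)
                         (2[j+1]+0≡n j) (ballot-binomial j 0)
      where
      2[j+1]+0≡n : ∀ j → suc j + suc j + 0 ≡ 2 * suc j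
      2[j+1]+0≡n = solve-∀
    scaled : suc (suc j) * ballot (suc j) 1 + suc j * C₁ ≡ C₁ + suc j * C₁
    scaled = trans (cong (suc (suc j) * ballot (suc j) 1 +_) (central-binomial-absorption j))
                   (trans (sym (*-distribˡ-+ (suc (suc j)) (ballot (suc j) 1) C₀))
                          (cong (suc (suc j) *_) ballot+C₀≡C₁))
    C₁≡ballot*[j+2] : C₁ ≡ ballot (suc j) 1 * suc (suc j)
    C₁≡ballot*[j+2] = sym (trans (*-comm (ballot (suc j) 1) (suc (suc j)))
                                (+-cancelʳ-≡ (suc j * C₁) _ _ scaled))

module SchröderSeries where

  open import Data.Nat as ℕ using (ℕ; zero; suc; _∸_; _≤_)
  open import Data.Nat.Properties as ℕ using ()
  open import Data.Nat.Combinatorics using (_C_; nCn≡1; k>n⇒nCk≡0)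
  import Data.Nat.Tactic.RingSolver as ℕ-Solver
  open import Data.Integer using (ℤ; +_; -_; _+_; _*_; _^_)
  open import Data.Integer.Properties as ℤ using ()
  open import Data.Integer.Tactic.RingSolver using (solve-∀)
  open import Data.List using (map; foldr; applyUpTo)
  open import Data.Sum using (_⊎_; inj₁; inj₂)
  open import Function using (id)
  open import Relation.Binary.PropositionalEquality
  open import Defs using (Σℤ; S; catalan)
  open PowerSeries
  open Ballot

  coeff : ℕ → ℕ → ℕ → ℕ
  coeff n m k = ((n ℕ.+ k ℕ.+ m) C (k ℕ.+ k ℕ.+ m)) ℕ.* ballot k (suc m)

  coeff↓m : ℕ → ℕ → ℕ → ℕ
  coeff↓m n zero    k = 0
  coeff↓m n (suc m) k = coeff (suc n) m k

  coeff↓k : ℕ → ℕ → ℕ → ℕ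
  coeff↓k n m zero    = 0
  coeff↓k n m (suc k) = coeff n (suc m) k

  shifted-pascal : ∀ n k m → (suc n ℕ.+ k ℕ.+ suc m) C (k ℕ.+ k ℕ.+ suc m)
                 ≡ (suc n ℕ.+ k ℕ.+ m) C (k ℕ.+ k ℕ.+ m) ℕ.+ (n ℕ.+ k ℕ.+ suc m) C (k ℕ.+ k ℕ.+ suc m)
  shifted-pascal n k m =
    trans (cong (suc (n ℕ.+ k ℕ.+ suc m) C_) (+suc k m))
          (trans (pascal (n ℕ.+ k ℕ.+ suc m) (k ℕ.+ k ℕ.+ m))
                 (cong₂ ℕ._+_ (cong (_C (k ℕ.+ k ℕ.+ m)) (n+k+[m+1] n k m))
                              (cong ((n ℕ.+ k ℕ.+ suc m) C_) (sym (+suc k m)))))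
    where
    +suc : ∀ k m → k ℕ.+ k ℕ.+ suc m ≡ suc (k ℕ.+ k ℕ.+ m)
    +suc = ℕ-Solver.solve-∀
    n+k+[m+1] : ∀ n k m → n ℕ.+ k ℕ.+ suc m ≡ suc n ℕ.+ k ℕ.+ m
    n+k+[m+1] = ℕ-Solver.solve-∀

  coeff-pascal : ∀ n m k → coeff (suc n) m k ≡ coeff↓m n m k ℕ.+ coeff n m k ℕ.+ coeff↓k n m k
  coeff-pascal n zero    zero    = refl
  coeff-pascal n zero    (suc k) =
    begin
      ((suc n ℕ.+ suc k ℕ.+ 0) C (suc k ℕ.+ suc k ℕ.+ 0)) ℕ.* ballot k 2
    ≡⟨ cong (ℕ._* ballot k 2) (pascal N K) ⟩
      (N C K ℕ.+ N C suc K) ℕ.* ballot k 2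
    ≡⟨ ℕ.*-distribʳ-+ (ballot k 2) (N C K) (N C suc K) ⟩
      (N C K) ℕ.* ballot k 2 ℕ.+ (N C suc K) ℕ.* ballot k 2
    ≡⟨ ℕ.+-comm ((N C K) ℕ.* ballot k 2) _ ⟩
      (N C suc K) ℕ.* ballot k 2 ℕ.+ (N C K) ℕ.* ballot k 2
    ≡⟨ cong (λ x → coeff n zero (suc k) ℕ.+ x ℕ.* ballot k 2)
            (cong₂ _C_ (n+[k+1]≡n+k+1 n k) (k+[k+1]≡k+k+1 k)) ⟩
      coeff n zero (suc k) ℕ.+ coeff n 1 k
    ∎
    where
    open ≡-Reasoning
    N = n ℕ.+ suc k ℕ.+ 0
    K = k ℕ.+ suc k ℕ.+ 0
    n+[k+1]≡n+k+1 : ∀ n k → n ℕ.+ suc k ℕ.+ 0 ≡ n ℕ.+ k ℕ.+ 1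
    n+[k+1]≡n+k+1 = ℕ-Solver.solve-∀
    k+[k+1]≡k+k+1 : ∀ k → k ℕ.+ suc k ℕ.+ 0 ≡ k ℕ.+ k ℕ.+ 1
    k+[k+1]≡k+k+1 = ℕ-Solver.solve-∀
  coeff-pascal n (suc m) zero    =
    trans (cong (ℕ._* 1) (shifted-pascal n 0 m))
          (trans (ℕ.*-distribʳ-+ 1 ((suc n ℕ.+ 0 ℕ.+ m) C m) ((n ℕ.+ 0 ℕ.+ suc m) C suc m))
                 (sym (ℕ.+-identityʳ _)))
  coeff-pascal n (suc m) (suc k) =
    begin
      ((suc n ℕ.+ suc k ℕ.+ suc m) C (suc k ℕ.+ suc k ℕ.+ suc m)) ℕ.* b₂
    ≡⟨ cong (ℕ._* b₂) (shifted-pascal n (suc k) m) ⟩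
      (C₁ ℕ.+ C₂) ℕ.* b₂
    ≡⟨ ℕ.*-distribʳ-+ b₂ C₁ C₂ ⟩
      C₁ ℕ.* (ballot (suc k) (suc m) ℕ.+ ballot k (3 ℕ.+ m)) ℕ.+ C₂ ℕ.* b₂
    ≡⟨ cong (ℕ._+ C₂ ℕ.* b₂) (ℕ.*-distribˡ-+ C₁ (ballot (suc k) (suc m)) (ballot k (3 ℕ.+ m))) ⟩
      C₁ ℕ.* ballot (suc k) (suc m) ℕ.+ C₁ ℕ.* ballot k (3 ℕ.+ m) ℕ.+ C₂ ℕ.* b₂
    ≡⟨ swap₂₃ (C₁ ℕ.* ballot (suc k) (suc m)) (C₁ ℕ.* ballot k (3 ℕ.+ m)) (C₂ ℕ.* b₂) ⟩
      coeff (suc n) m (suc k) ℕ.+ coeff n (suc m) (suc k) ℕ.+ C₁ ℕ.* ballot k (3 ℕ.+ m)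
    ≡⟨ cong (λ x → coeff (suc n) m (suc k) ℕ.+ coeff n (suc m) (suc k) ℕ.+ x ℕ.* ballot k (3 ℕ.+ m))
            (cong₂ _C_ (top n k m) (bottom k m)) ⟩
      coeff (suc n) m (suc k) ℕ.+ coeff n (suc m) (suc k) ℕ.+ coeff n (suc (suc m)) k
    ∎
    where
    open ≡-Reasoning
    b₂ = ballot (suc k) (suc (suc m))
    C₁ = (suc n ℕ.+ suc k ℕ.+ m) C (suc k ℕ.+ suc k ℕ.+ m)
    C₂ = (n ℕ.+ suc k ℕ.+ suc m) C (suc k ℕ.+ suc k ℕ.+ suc m)
    swap₂₃ : ∀ a b c → a ℕ.+ b ℕ.+ c ≡ a ℕ.+ c ℕ.+ b
    swap₂₃ = ℕ-Solver.solve-∀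
    top : ∀ n k m → suc n ℕ.+ suc k ℕ.+ m ≡ n ℕ.+ k ℕ.+ suc (suc m)
    top = ℕ-Solver.solve-∀
    bottom : ∀ k m → suc k ℕ.+ suc k ℕ.+ m ≡ k ℕ.+ k ℕ.+ suc (suc m)
    bottom = ℕ-Solver.solve-∀

  coeff-top : ∀ n m → coeff n m (suc n) ≡ 0
  coeff-top n m =
    cong (ℕ._* ballot (suc n) (suc m))
         (k>n⇒nCk≡0 {n ℕ.+ suc n ℕ.+ m} {suc n ℕ.+ suc n ℕ.+ m} ℕ.≤-refl)

  -- power m = S(α,β)ᵐ, expanded with the coefficients ballot k (m+1) of C(t)ᵐ⁺¹.
  module SchröderPowers (α β : ℤ) where

    term : ℕ → ℕ → ℕ → ℤ
    term n m k = + coeff n m k * (α ^ (n ∸ k) * β ^ k)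

    power : ℕ → Series
    power zero      = 𝟏
    power (suc m) n = sum≤ n (term n m)

    power-head : ∀ m → power m 0 ≡ + 1
    power-head zero    = refl
    power-head (suc m) = cong (λ c → + (c ℕ.* 1) * (+ 1 * + 1)) (nCn≡1 m)

    term↓m : ℕ → ℕ → ℕ → ℤ
    term↓m n zero    k = + 0
    term↓m n (suc m) k = term (suc n) m k

    term↓k : ℕ → ℕ → ℕ → ℤ
    term↓k n m zero    = + 0
    term↓k n m (suc k) = β * term n (suc m) k

    term-top : ∀ n m → term n m (suc n) ≡ + 0
    term-top n m = cong (λ c → + c * (α ^ (n ∸ suc n) * β ^ suc n)) (coeff-top n m)

    term-pascal : ∀ n m k → k ≤ suc n → term (suc n) m k ≡ term↓m n m k + α * term n m k + term↓k n m k
    term-pascal n m k k≤1+n =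
      begin
        + coeff (suc n) m k * w
      ≡⟨ cong (λ c → + c * w) (coeff-pascal n m k) ⟩
        + (coeff↓m n m k ℕ.+ coeff n m k ℕ.+ coeff↓k n m k) * w
      ≡⟨ cong (_* w) (trans (ℤ.pos-+ (coeff↓m n m k ℕ.+ coeff n m k) (coeff↓k n m k))
                               (cong (_+ + coeff↓k n m k) (ℤ.pos-+ (coeff↓m n m k) (coeff n m k)))) ⟩
        (+ coeff↓m n m k + + coeff n m k + + coeff↓k n m k) * w
      ≡⟨ distrib (+ coeff↓m n m k) (+ coeff n m k) (+ coeff↓k n m k) w ⟩
        + coeff↓m n m k * w + + coeff n m k * w + + coeff↓k n m k * w
      ≡⟨ cong₂ _+_ (cong₂ _+_ (↓m m) (middle (ℕ.m≤n⇒m<n∨m≡n k≤1+n))) (↓k k) ⟩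
        term↓m n m k + α * term n m k + term↓k n m k
      ∎
      where
      open ≡-Reasoning
      w = α ^ (suc n ∸ k) * β ^ k
      distrib : ∀ x y v w → (x + y + v) * w ≡ x * w + y * w + v * w
      distrib = solve-∀
      ↓m : ∀ m → + coeff↓m n m k * w ≡ term↓m n m k
      ↓m zero    = ℤ.*-zeroˡ w
      ↓m (suc m) = refl
      ↓k : ∀ k → + coeff↓k n m k * (α ^ (suc n ∸ k) * β ^ k) ≡ term↓k n m k
      ↓k zero    = ℤ.*-zeroˡ (α ^ suc n * + 1)
      ↓k (suc k) = pull (+ coeff n (suc m) k) (α ^ (n ∸ k)) β (β ^ k)
        where
        pull : ∀ c a β b → c * (a * (β * b)) ≡ β * (c * (a * b))
        pull = solve-∀
      middle : k ℕ.< suc n ⊎ k ≡ suc n → + coeff n m k * w ≡ α * term n m k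
      middle (inj₁ k≤n) =
        trans (cong (λ e → + coeff n m k * (α ^ e * β ^ k)) (ℕ.+-∸-assoc 1 (ℕ.s≤s⁻¹ k≤n)))
              (pull (+ coeff n m k) α (α ^ (n ∸ k)) (β ^ k))
        where
        pull : ∀ c α a b → c * ((α * a) * b) ≡ α * (c * (a * b))
        pull = solve-∀
      middle (inj₂ refl) =
        trans (cong (λ c → + c * w) (coeff-top n m))
              (trans (ℤ.*-zeroˡ w) (sym (trans (cong (α *_) (term-top n m)) (ℤ.*-zeroʳ α))))

    sum-term↓m : ∀ n m → sum≤ (suc n) (term↓m n m) ≡ power m (suc n)
    sum-term↓m n zero    = sum≤-zero (suc n) _ (λ _ _ → refl)
    sum-term↓m n (suc m) = refl

    sum-term : ∀ n m → sum≤ (suc n) (term n m) ≡ power (suc m) n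
    sum-term n m = sum≤-suc-vanishing n (term n m) (term-top n m)

    sum-term↓k : ∀ n m → sum≤ (suc n) (term↓k n m) ≡ β * power (suc (suc m)) n
    sum-term↓k n m = trans (ℤ.+-identityˡ _) (sum≤-*ˡ n β (term n (suc m)))

    power-recurrence : Recurrence (const α) (const β) power
    power-recurrence m zero    =
      trans (power-head (suc m)) (trans (sym (ℤ.+-identityʳ (+ 1))) (cong (_+ + 0) (sym (power-head m))))
    power-recurrence m (suc n) =
      begin
        sum≤ (suc n) (term (suc n) m)
      ≡⟨ sum≤-cong-≤ (suc n) (term-pascal n m) ⟩
        sum≤ (suc n) (λ k → term↓m n m k + α * term n m k + term↓k n m k)
      ≡⟨ sum≤-distrib-+ (suc n) (λ k → term↓m n m k + α * term n m k) (term↓k n m) ⟩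
        sum≤ (suc n) (λ k → term↓m n m k + α * term n m k) + sum≤ (suc n) (term↓k n m)
      ≡⟨ cong (_+ sum≤ (suc n) (term↓k n m)) (sum≤-distrib-+ (suc n) (term↓m n m) (λ k → α * term n m k)) ⟩
        sum≤ (suc n) (term↓m n m) + sum≤ (suc n) (λ k → α * term n m k) + sum≤ (suc n) (term↓k n m)
      ≡⟨ cong₂ (λ x y → x + y + sum≤ (suc n) (term↓k n m)) (sum-term↓m n m)
               (trans (sum≤-*ˡ (suc n) α (term n m)) (cong (α *_) (sum-term n m))) ⟩
        power m (suc n) + α * power (suc m) n + sum≤ (suc n) (term↓k n m)
      ≡⟨ cong (_+_ (power m (suc n) + α * power (suc m) n)) (sum-term↓k n m) ⟩
        power m (suc n) + α * power (suc m) n + β * power (suc (suc m)) n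
      ≡⟨ ℤ.+-assoc (power m (suc n)) _ _ ⟩
        power m (suc n) + (α * power (suc m) n + β * power (suc (suc m)) n)
      ≡⟨ cong (_+_ (power m (suc n))) step ⟨
        power m (suc n) + (z ⊛ (const α ⊛ power (suc m) ⊕ const β ⊛ power (suc (suc m)))) (suc n)
      ∎
      where
      open ≡-Reasoning
      step : (z ⊛ (const α ⊛ power (suc m) ⊕ const β ⊛ power (suc (suc m)))) (suc n)
           ≡ α * power (suc m) n + β * power (suc (suc m)) n
      step = trans (z⊛-suc (const α ⊛ power (suc m) ⊕ const β ⊛ power (suc (suc m))) n)
                   (cong₂ _+_ (const-⊛ α (power (suc m)) n) (const-⊛ β (power (suc (suc m))) n))

    power-1-equation : power 1 ≈ 𝟏 ⊕ z ⊛ (const α ⊛ power 1 ⊕ const β ⊛ (power 1 ⊛ power 1))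
    power-1-equation =
      ≈-trans (power-recurrence 0)
              (⊕-cong (≈-refl {𝟏}) (⊛-congʳ z (⊕-cong (≈-refl {const α ⊛ power 1})
                (⊛-congʳ (const β) (recurrence-square {const α} {const β} {power} power-recurrence ≈-refl)))))

  Σℤ≡sum≤ : ∀ n f → Σℤ n f ≡ sum≤ n f
  Σℤ≡sum≤ n f = go f id n
    where
    go : ∀ (f : ℕ → ℤ) (g : ℕ → ℕ) n → foldr _+_ (+ 0) (map f (applyUpTo g (suc n))) ≡ sum≤ n (λ i → f (g i))
    go f g zero    = ℤ.+-identityʳ (f (g 0))
    go f g (suc n) = cong (_+_ (f (g 0))) (go f (λ i → g (suc i)) n)

  S≈power-1 : ∀ α β → S α β ≈ SchröderPowers.power α β 1
  S≈power-1 α β n =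
    trans (Σℤ≡sum≤ n _)
          (sum≤-cong n (λ k → cong (λ c → + c * (α ^ (n ∸ k) * β ^ k))
            (cong₂ ℕ._*_ (cong₂ _C_ (n+k≡n+k+0 n k) (2k≡k+k+0 k)) (sym (ballot-1≡catalan k)))))
    where
    n+k≡n+k+0 : ∀ n k → n ℕ.+ k ≡ n ℕ.+ k ℕ.+ 0
    n+k≡n+k+0 = ℕ-Solver.solve-∀
    2k≡k+k+0 : ∀ k → 2 ℕ.* k ≡ k ℕ.+ k ℕ.+ 0
    2k≡k+k+0 = ℕ-Solver.solve-∀

  S-equation : ∀ α β → S α β ≈ 𝟏 ⊕ z ⊛ (const α ⊛ S α β ⊕ const β ⊛ (S α β ⊛ S α β))
  S-equation α β =
    ≈-trans (S≈power-1 α β)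
      (≈-trans power-1-equation
        (⊕-cong (≈-refl {𝟏}) (⊛-congʳ z (⊕-cong (⊛-congʳ (const α) S≈)
                                                (⊛-congʳ (const β) (⊛-cong S≈ S≈))))))
    where
    open SchröderPowers α β
    S≈ = ≈-sym (S≈power-1 α β)

  ^-distrib-* : ∀ x y n → (x * y) ^ n ≡ x ^ n * y ^ n
  ^-distrib-* x y zero    = refl
  ^-distrib-* x y (suc n) = trans (cong ((x * y) *_) (^-distrib-* x y n)) (interchange x y (x ^ n) (y ^ n))
    where
    interchange : ∀ x y u v → (x * y) * (u * v) ≡ (x * u) * (y * v)
    interchange = solve-∀

  S-sign-flip : ∀ a c m → (- + 1) ^ m * S (- a) c m ≡ S a (- c) m
  S-sign-flip a c m =
    trans (cong ((- + 1) ^ m *_) (Σℤ≡sum≤ m _))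
          (trans (sym (sum≤-*ˡ m ((- + 1) ^ m) _))
                 (trans (sum≤-cong-≤ m term) (sym (Σℤ≡sum≤ m _))))
    where
    neg-^ : ∀ x n → (- x) ^ n ≡ (- + 1) ^ n * x ^ n
    neg-^ x n = trans (cong (_^ n) (sym (ℤ.-1*i≡-i x))) (^-distrib-* (- + 1) x n)
    -1^n*-1^n : ∀ n → (- + 1) ^ n * (- + 1) ^ n ≡ + 1
    -1^n*-1^n n = trans (sym (^-distrib-* (- + 1) (- + 1) n)) (ℤ.^-zeroˡ n)
    regroup : ∀ s t κ u v → (s * t) * (κ * ((t * u) * v)) ≡ κ * ((t * t) * (u * (s * v)))
    regroup = solve-∀
    term : ∀ k → k ≤ m →
      (- + 1) ^ m * (+ (((m ℕ.+ k) C (2 ℕ.* k)) ℕ.* catalan k) * ((- a) ^ (m ∸ k) * c ^ k))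
        ≡ + (((m ℕ.+ k) C (2 ℕ.* k)) ℕ.* catalan k) * (a ^ (m ∸ k) * (- c) ^ k)
    term k k≤m =
      begin
        (- + 1) ^ m * (κ * ((- a) ^ (m ∸ k) * c ^ k))
      ≡⟨ cong₂ (λ s t → s * (κ * (t * c ^ k)))
               (trans (cong ((- + 1) ^_) (sym (ℕ.m+[n∸m]≡n k≤m))) (ℤ.^-distribˡ-+-* (- + 1) k (m ∸ k)))
               (neg-^ a (m ∸ k)) ⟩
        ((- + 1) ^ k * (- + 1) ^ (m ∸ k)) * (κ * (((- + 1) ^ (m ∸ k) * a ^ (m ∸ k)) * c ^ k))
      ≡⟨ regroup ((- + 1) ^ k) ((- + 1) ^ (m ∸ k)) κ (a ^ (m ∸ k)) (c ^ k) ⟩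
        κ * (((- + 1) ^ (m ∸ k) * (- + 1) ^ (m ∸ k)) * (a ^ (m ∸ k) * ((- + 1) ^ k * c ^ k)))
      ≡⟨ cong₂ (λ one t → κ * (one * (a ^ (m ∸ k) * t))) (-1^n*-1^n (m ∸ k)) (sym (neg-^ c k)) ⟩
        κ * (+ 1 * (a ^ (m ∸ k) * (- c) ^ k))
      ≡⟨ cong (κ *_) (ℤ.*-identityˡ _) ⟩
        κ * (a ^ (m ∸ k) * (- c) ^ k)
      ∎
      where
      open ≡-Reasoning
      κ = + (((m ℕ.+ k) C (2 ℕ.* k)) ℕ.* catalan k)

module ListSum where

  open import Data.Nat using (zero; suc; _∸_)
  open import Data.Integer using (ℤ; +_; _+_; _*_)
  open import Data.Integer.Properties as ℤ using ()
  open import Data.Integer.Tactic.RingSolver using (solve-∀)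
  open import Data.Bool using (Bool; true; false; not)
  open import Data.Fin using (Fin; zero; suc)
  open import Data.Fin.Properties using (_≟_)
  open import Data.List using (List; []; _∷_; _++_; map; concat; concatMap; allFin)
  open import Data.List.Properties using (map-tabulate)
  open import Function using (_∘_; id)
  open import Relation.Nullary.Decidable using (⌊_⌋; isYes≗does)
  open import Relation.Binary.PropositionalEquality

  sumL : {X : Set} → (X → ℤ) → List X → ℤ
  sumL f []       = + 0
  sumL f (x ∷ xs) = f x + sumL f xs

  sumL-cong : {X : Set} {f g : X → ℤ} (xs : List X) → (∀ x → f x ≡ g x) → sumL f xs ≡ sumL g xs
  sumL-cong []       e = refl
  sumL-cong (x ∷ xs) e = cong₂ _+_ (e x) (sumL-cong xs e)

  sumL-zero : {X : Set} (f : X → ℤ) (xs : List X) → (∀ x → f x ≡ + 0) → sumL f xs ≡ + 0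
  sumL-zero f []       e = refl
  sumL-zero f (x ∷ xs) e = cong₂ _+_ (e x) (sumL-zero f xs e)

  sumL-++ : {X : Set} (f : X → ℤ) (xs ys : List X) → sumL f (xs ++ ys) ≡ sumL f xs + sumL f ys
  sumL-++ f []       ys = sym (ℤ.+-identityˡ _)
  sumL-++ f (x ∷ xs) ys = trans (cong (_+_ (f x)) (sumL-++ f xs ys)) (sym (ℤ.+-assoc (f x) _ _))

  sumL-map : {X W : Set} (f : W → ℤ) (g : X → W) (xs : List X) → sumL f (map g xs) ≡ sumL (f ∘ g) xs
  sumL-map f g []       = refl
  sumL-map f g (x ∷ xs) = cong (_+_ (f (g x))) (sumL-map f g xs)

  sumL-concatMap : {X W : Set} (f : W → ℤ) (F : X → List W) (xs : List X) →
                   sumL f (concatMap F xs) ≡ sumL (λ x → sumL f (F x)) xs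
  sumL-concatMap f F []       = refl
  sumL-concatMap f F (x ∷ xs) =
    trans (sumL-++ f (F x) (concat (map F xs))) (cong (_+_ (sumL f (F x))) (sumL-concatMap f F xs))

  sumL-distrib-+ : {X : Set} (f g : X → ℤ) (xs : List X) → sumL (λ x → f x + g x) xs ≡ sumL f xs + sumL g xs
  sumL-distrib-+ f g []       = refl
  sumL-distrib-+ f g (x ∷ xs) =
    trans (cong (_+_ (f x + g x)) (sumL-distrib-+ f g xs)) (interchange (f x) (g x) (sumL f xs) (sumL g xs))
    where
    interchange : ∀ a b c d → (a + b) + (c + d) ≡ (a + c) + (b + d)
    interchange = solve-∀

  sumL-*ˡ : {X : Set} (c : ℤ) (f : X → ℤ) (xs : List X) → sumL (λ x → c * f x) xs ≡ c * sumL f xs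
  sumL-*ˡ c f []       = sym (ℤ.*-zeroʳ c)
  sumL-*ˡ c f (x ∷ xs) = trans (cong (_+_ (c * f x)) (sumL-*ˡ c f xs)) (sym (ℤ.*-distribˡ-+ c (f x) _))

  sumL-swap : {X W : Set} (f : X → W → ℤ) (xs : List X) (ys : List W) →
              sumL (λ x → sumL (f x) ys) xs ≡ sumL (λ y → sumL (λ x → f x y) xs) ys
  sumL-swap f []       ys = sym (sumL-zero _ ys (λ _ → refl))
  sumL-swap f (x ∷ xs) ys =
    trans (cong (_+_ (sumL (f x) ys)) (sumL-swap f xs ys))
          (sym (sumL-distrib-+ (f x) (λ y → sumL (λ x → f x y) xs) ys))

  sumL-allFin-suc : ∀ n (f : Fin (suc n) → ℤ) → sumL f (allFin (suc n)) ≡ f zero + sumL (f ∘ suc) (allFin n)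
  sumL-allFin-suc n f = cong (_+_ (f zero)) (trans (cong (sumL f) (sym (map-tabulate id suc))) (sumL-map f suc (allFin n)))

  +[1+n]* : ∀ n K → + suc n * K ≡ K + + n * K
  +[1+n]* n K = trans (cong (_* K) (ℤ.pos-+ 1 n)) (trans (ℤ.*-distribʳ-+ K (+ 1) (+ n)) (cong (_+ + n * K) (ℤ.*-identityˡ K)))

  sumL-allFin-const : ∀ n (f : Fin n → ℤ) K → (∀ c → f c ≡ K) → sumL f (allFin n) ≡ + n * K
  sumL-allFin-const zero    f K e = sym (ℤ.*-zeroˡ K)
  sumL-allFin-const (suc n) f K e =
    trans (sumL-allFin-suc n f)
          (trans (cong₂ _+_ (e zero) (sumL-allFin-const n (f ∘ suc) K (e ∘ suc))) (sym (+[1+n]* n K)))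

  𝟙 : Bool → ℤ
  𝟙 true  = + 1
  𝟙 false = + 0

  ⌊suc≟suc⌋ : ∀ {n} (c c′ : Fin n) → ⌊ suc c ≟ suc c′ ⌋ ≡ ⌊ c ≟ c′ ⌋
  ⌊suc≟suc⌋ c c′ = trans (isYes≗does (suc c ≟ suc c′)) (sym (isYes≗does (c ≟ c′)))

  sumL-allFin-≢ : ∀ n (c : Fin n) (f : Fin n → ℤ) K → (∀ c′ → f c′ ≡ K) →
                  sumL (λ c′ → 𝟙 (not ⌊ c ≟ c′ ⌋) * f c′) (allFin n) ≡ + (n ∸ 1) * K
  sumL-allFin-≢ (suc n) zero    f K e =
    trans (sumL-allFin-suc n (λ c′ → 𝟙 (not ⌊ zero ≟ c′ ⌋) * f c′))
          (trans (ℤ.+-identityˡ _)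
                 (sumL-allFin-const n _ K (λ c′ → trans (ℤ.*-identityˡ (f (suc c′))) (e (suc c′)))))
  sumL-allFin-≢ (suc (suc n)) (suc c) f K e =
    trans (sumL-allFin-suc (suc n) (λ c′ → 𝟙 (not ⌊ suc c ≟ c′ ⌋) * f c′))
          (trans (cong₂ _+_ (trans (ℤ.*-identityˡ (f zero)) (e zero)) others) (sym (+[1+n]* n K)))
    where
    others : sumL (λ c′ → 𝟙 (not ⌊ suc c ≟ suc c′ ⌋) * f (suc c′)) (allFin (suc n)) ≡ + n * K
    others = trans (sumL-cong (allFin (suc n)) (λ c′ → cong (λ t → 𝟙 (not t) * f (suc c′)) (⌊suc≟suc⌋ c c′)))
                   (sumL-allFin-≢ (suc n) c (f ∘ suc) K (e ∘ suc))

module Substitution (b : ℤ) where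

  open import Data.Nat as ℕ using (ℕ; zero; suc; _<_)
  open import Data.Nat.Properties as ℕ using ()
  import Data.Nat.Tactic.RingSolver as ℕ-Solver
  open import Data.Integer using (+_; -_; _+_; _*_; _^_)
  open import Data.Integer.Properties as ℤ using ()
  open import Data.Integer.Tactic.RingSolver using (solve-∀)
  open import Relation.Binary.PropositionalEquality
  open import Defs using (S)
  open PowerSeries
  open SchröderSeries using (S-equation)

  A B : Series
  A = S (+ 1) b
  B = const b

  A-equation : A ≈ 𝟏 ⊕ z ⊛ (𝟏 ⊛ A ⊕ B ⊛ (A ⊛ A))
  A-equation = S-equation (+ 1) b

  A-head : A 0 ≡ + 1
  A-head = A-equation 0

  A^-recurrence : Recurrence 𝟏 B (A ^ₛ_)
  A^-recurrence m = ≈-trans (⊛-congˡ (A ^ₛ m) A-equation) (expand A (A ^ₛ m) z B)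
    where
    expand : ∀ a p z b →
      (𝟏 ⊕ z ⊛ (𝟏 ⊛ a ⊕ b ⊛ (a ⊛ a))) ⊛ p ≈ p ⊕ z ⊛ (𝟏 ⊛ (a ⊛ p) ⊕ b ⊛ (a ⊛ (a ⊛ p)))
    expand = solve 4 (λ a p z b →
      (con (+ 1) :+ z :* (con (+ 1) :* a :+ b :* (a :* a))) :* p
        := p :+ z :* (con (+ 1) :* (a :* p) :+ b :* (a :* (a :* p))))
      ≈-refl

  -- Σₗ aₗ G ℓ k = Aᵏ · a(-b z A²) for every series a.
  G : ℕ → ℕ → Series
  G ℓ k = const ((- b) ^ ℓ) ⊛ (z ^ₛ ℓ ⊛ A ^ₛ (ℓ ℕ.+ ℓ ℕ.+ k))

  G-recurrence : ∀ ℓ → Recurrence 𝟏 B (G ℓ)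
  G-recurrence ℓ =
    recurrence-⊛ {𝟏} {B} {λ k → z ^ₛ ℓ ⊛ A ^ₛ (ℓ ℕ.+ ℓ ℕ.+ k)} (const ((- b) ^ ℓ))
      (recurrence-⊛ {𝟏} {B} {λ k → A ^ₛ (ℓ ℕ.+ ℓ ℕ.+ k)} (z ^ₛ ℓ)
        (recurrence-shift {𝟏} {B} {A ^ₛ_} (ℓ ℕ.+ ℓ) A^-recurrence))

  G-zero : ∀ k → G 0 k ≈ A ^ₛ k
  G-zero k = ≈-trans (⊛-identityˡ _) (⊛-identityˡ _)

  G-suc : ∀ ℓ k → G (suc ℓ) k ≈ const (- b) ⊛ (z ⊛ G ℓ (suc (suc k)))
  G-suc ℓ k =
    ≈-trans (⊛-cong (const-⊛-const (- b) ((- b) ^ ℓ))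
                    (⊛-congʳ (z ⊛ z ^ₛ ℓ) (^ₛ-≡ A (2[ℓ+1]+k≡2ℓ+[k+2] ℓ k))))
            (regroup (const (- b)) (const ((- b) ^ ℓ)) z (z ^ₛ ℓ) (A ^ₛ (ℓ ℕ.+ ℓ ℕ.+ suc (suc k))))
    where
    2[ℓ+1]+k≡2ℓ+[k+2] : ∀ ℓ k → suc ℓ ℕ.+ suc ℓ ℕ.+ k ≡ ℓ ℕ.+ ℓ ℕ.+ suc (suc k)
    2[ℓ+1]+k≡2ℓ+[k+2] = ℕ-Solver.solve-∀
    regroup : ∀ c₁ c z w p → (c₁ ⊛ c) ⊛ ((z ⊛ w) ⊛ p) ≈ c₁ ⊛ (z ⊛ (c ⊛ (w ⊛ p)))
    regroup = solve 5 (λ c₁ c z w p → (c₁ :* c) :* ((z :* w) :* p) := c₁ :* (z :* (c :* (w :* p))))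
      ≈-refl

  G-suc-coeff : ∀ ℓ k n → G (suc ℓ) k (suc n) ≡ - b * G ℓ (suc (suc k)) n
  G-suc-coeff ℓ k n =
    trans (G-suc ℓ k (suc n))
          (trans (const-⊛ (- b) (z ⊛ G ℓ (suc (suc k))) (suc n))
                 (cong (_*_ (- b)) (z⊛-suc (G ℓ (suc (suc k))) n)))

  G-low : ∀ ℓ k i → i < ℓ → G ℓ k i ≡ + 0
  G-low ℓ k i i<ℓ =
    trans (const-⊛ ((- b) ^ ℓ) (z ^ₛ ℓ ⊛ A ^ₛ (ℓ ℕ.+ ℓ ℕ.+ k)) i)
          (trans (cong ((- b) ^ ℓ *_) (z^ₛ⊛-low ℓ (A ^ₛ (ℓ ℕ.+ ℓ ℕ.+ k)) i i<ℓ)) (ℤ.*-zeroʳ ((- b) ^ ℓ)))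

  -- H k j = Aᵏ · (Aʲ)(-b z A²); the sum may stop at ℓ = n since G ℓ k n = 0 for ℓ > n.
  H : ℕ → ℕ → Series
  H k j n = sum≤ n (λ ℓ → (A ^ₛ j) ℓ * G ℓ k n)

  H-recurrence-k : ∀ j → Recurrence 𝟏 B (λ k → H k j)
  H-recurrence-k j = recurrence-from-coeffs {+ 1} {b} {λ k → H k j} at-zero at-suc
    where
    a = A ^ₛ j
    at-zero : ∀ k → H (suc k) j 0 ≡ H k j 0
    at-zero k = cong (a 0 *_) (recurrence-coeff-zero {+ 1} {b} {G 0} (G-recurrence 0) k)
    distribute : ∀ b a g₀ g₁ g₂ → a * (g₀ + (+ 1 * g₁ + b * g₂)) ≡ a * g₀ + (+ 1 * (a * g₁) + b * (a * g₂))
    distribute = solve-∀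
    at-suc : ∀ k n → H (suc k) j (suc n) ≡ H k j (suc n) + (+ 1 * H (suc k) j n + b * H (suc (suc k)) j n)
    at-suc k n =
      begin
        sum≤ (suc n) (λ ℓ → a ℓ * G ℓ (suc k) (suc n))
      ≡⟨ sum≤-cong (suc n) (λ ℓ → trans (cong (a ℓ *_) (recurrence-coeff-suc {+ 1} {b} {G ℓ} (G-recurrence ℓ) k n))
                                         (distribute b (a ℓ) (G ℓ k (suc n)) (G ℓ (suc k) n) (G ℓ (suc (suc k)) n))) ⟩
        sum≤ (suc n) (λ ℓ → a ℓ * G ℓ k (suc n) + lower ℓ)
      ≡⟨ sum≤-distrib-+ (suc n) (λ ℓ → a ℓ * G ℓ k (suc n)) lower ⟩
        H k j (suc n) + sum≤ (suc n) lower
      ≡⟨ cong (_+_ (H k j (suc n))) (sum≤-suc-vanishing n lower lower-top) ⟩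
        H k j (suc n) + sum≤ n lower
      ≡⟨ cong (_+_ (H k j (suc n)))
              (sum≤-linear n (+ 1) b (λ ℓ → a ℓ * G ℓ (suc k) n) (λ ℓ → a ℓ * G ℓ (suc (suc k)) n)) ⟩
        H k j (suc n) + (+ 1 * H (suc k) j n + b * H (suc (suc k)) j n)
      ∎
      where
      open ≡-Reasoning
      lower : ℕ → ℤ
      lower ℓ = + 1 * (a ℓ * G ℓ (suc k) n) + b * (a ℓ * G ℓ (suc (suc k)) n)
      vanish : ∀ k → a (suc n) * G (suc n) k n ≡ + 0
      vanish k = trans (cong (a (suc n) *_) (G-low (suc n) k n ℕ.≤-refl)) (ℤ.*-zeroʳ (a (suc n)))
      lower-top : lower (suc n) ≡ + 0
      lower-top = trans (cong₂ (λ x y → + 1 * x + b * y) (vanish (suc k)) (vanish (suc (suc k))))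
                        (cong (_+_ (+ 0)) (ℤ.*-zeroʳ b))

  H-recurrence-j : ∀ k j →
    H k (suc j) ≈ H k j ⊕ z ⊛ (const (- b) ⊛ H (suc (suc k)) (suc j) ⊕ const (- (b * b)) ⊛ H (suc (suc k)) (suc (suc j)))
  H-recurrence-j k j zero    =
    trans (cong (_* G 0 k 0) (recurrence-coeff-zero {+ 1} {b} {A ^ₛ_} A^-recurrence j)) (sym (ℤ.+-identityʳ _))
  H-recurrence-j k j (suc n) =
    begin
      a₁ 0 * G 0 k (suc n) + sum≤ n (λ ℓ → a₁ (suc ℓ) * G (suc ℓ) k (suc n))
    ≡⟨ cong₂ _+_ (cong (_* G 0 k (suc n)) (recurrence-coeff-zero {+ 1} {b} {A ^ₛ_} A^-recurrence j))
                 (sum≤-cong n split) ⟩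
      a₀ 0 * G 0 k (suc n) + sum≤ n (λ ℓ → a₀ (suc ℓ) * G (suc ℓ) k (suc n) + lower ℓ)
    ≡⟨ cong (_+_ (a₀ 0 * G 0 k (suc n))) (sum≤-distrib-+ n _ lower) ⟩
      a₀ 0 * G 0 k (suc n) + (sum≤ n (λ ℓ → a₀ (suc ℓ) * G (suc ℓ) k (suc n)) + sum≤ n lower)
    ≡⟨ ℤ.+-assoc (a₀ 0 * G 0 k (suc n)) _ _ ⟨
      H k j (suc n) + sum≤ n lower
    ≡⟨ cong (_+_ (H k j (suc n))) (sum≤-linear n (- b) (- (b * b)) (λ ℓ → a₁ ℓ * g ℓ) (λ ℓ → a₂ ℓ * g ℓ)) ⟩
      H k j (suc n) + (- b * H (suc (suc k)) (suc j) n + - (b * b) * H (suc (suc k)) (suc (suc j)) n)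
    ≡⟨ z-step-suc (H k j) (- b) (H (suc (suc k)) (suc j)) (- (b * b)) (H (suc (suc k)) (suc (suc j))) n ⟨
      (H k j ⊕ z ⊛ (const (- b) ⊛ H (suc (suc k)) (suc j) ⊕ const (- (b * b)) ⊛ H (suc (suc k)) (suc (suc j)))) (suc n)
    ∎
    where
    open ≡-Reasoning
    a₀ a₁ a₂ : Series
    a₀ = A ^ₛ j
    a₁ = A ^ₛ suc j
    a₂ = A ^ₛ suc (suc j)
    g : ℕ → ℤ
    g ℓ = G ℓ (suc (suc k)) n
    lower : ℕ → ℤ
    lower ℓ = - b * (a₁ ℓ * g ℓ) + - (b * b) * (a₂ ℓ * g ℓ)
    distribute : ∀ b x p q g → (x + (+ 1 * p + b * q)) * (- b * g) ≡ x * (- b * g) + (- b * (p * g) + - (b * b) * (q * g))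
    distribute = solve-∀
    split : ∀ ℓ → a₁ (suc ℓ) * G (suc ℓ) k (suc n) ≡ a₀ (suc ℓ) * G (suc ℓ) k (suc n) + lower ℓ
    split ℓ =
      begin
        a₁ (suc ℓ) * G (suc ℓ) k (suc n)
      ≡⟨ cong₂ _*_ (recurrence-coeff-suc {+ 1} {b} {A ^ₛ_} A^-recurrence j ℓ) (G-suc-coeff ℓ k n) ⟩
        (a₀ (suc ℓ) + (+ 1 * a₁ ℓ + b * a₂ ℓ)) * (- b * g ℓ)
      ≡⟨ distribute b (a₀ (suc ℓ)) (a₁ ℓ) (a₂ ℓ) (g ℓ) ⟩
        a₀ (suc ℓ) * (- b * g ℓ) + lower ℓ
      ≡⟨ cong (λ t → a₀ (suc ℓ) * t + lower ℓ) (G-suc-coeff ℓ k n) ⟨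
        a₀ (suc ℓ) * G (suc ℓ) k (suc n) + lower ℓ
      ∎

  H-zero : ∀ k → H k 0 ≈ A ^ₛ k
  H-zero k zero    = trans (ℤ.*-identityˡ (G 0 k 0)) (G-zero k 0)
  H-zero k (suc n) =
    trans (cong₂ _+_ (ℤ.*-identityˡ (G 0 k (suc n))) (sum≤-zero n _ (λ i _ → ℤ.*-zeroˡ (G (suc i) k (suc n)))))
          (trans (ℤ.+-identityʳ _) (G-zero k (suc n)))

  H-factor : ∀ j k → H k j ≈ A ^ₛ k ⊛ H 0 j
  H-factor j = recurrence-factor {𝟏} {B} {λ k → H k j} {A ^ₛ_} (H-recurrence-k j) A^-recurrence ≈-refl

  U : ℕ → Series
  U j = H 0 j

  V : Series
  V = U 1

  A² : Series
  A² = A ^ₛ 2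

  U-recurrence : Recurrence (⊝ B ⊛ A²) (⊝ (B ⊛ B) ⊛ A²) U
  U-recurrence j =
    ≈-trans (H-recurrence-j 0 j)
            (⊕-cong (≈-refl {U j}) (⊛-congʳ z (⊕-cong (factor (const-neg b) (suc j))
                                                       (factor const-neg-b² (suc (suc j))))))
    where
    const-neg-b² : const (- (b * b)) ≈ ⊝ (B ⊛ B)
    const-neg-b² = ≈-trans (const-neg (b * b)) (⊝-cong (const-⊛-const b b))
    factor : ∀ {c c′} → c ≈ c′ → ∀ j → c ⊛ H 2 j ≈ (c′ ⊛ A²) ⊛ U j
    factor {c} {c′} c≈c′ j = ≈-trans (⊛-cong c≈c′ (H-factor j 2)) (≈-sym (⊛-assoc c′ A² (U j)))

  V-equation : V ≈ 𝟏 ⊕ z ⊛ ((⊝ B ⊛ A²) ⊛ V ⊕ (⊝ (B ⊛ B) ⊛ A²) ⊛ (V ⊛ V))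
  V-equation =
    ≈-trans (U-recurrence 0)
            (⊕-cong (H-zero 0) (⊛-congʳ z (⊕-cong (≈-refl {(⊝ B ⊛ A²) ⊛ V})
              (⊛-congʳ (⊝ (B ⊛ B) ⊛ A²)
                (recurrence-square {⊝ B ⊛ A²} {⊝ (B ⊛ B) ⊛ A²} {U} U-recurrence (H-zero 0))))))

  Y : Series
  Y = S (+ 1) (- (b * b))

  Y-equation : Y ≈ 𝟏 ⊕ z ⊛ (𝟏 ⊛ Y ⊕ ⊝ (B ⊛ B) ⊛ (Y ⊛ Y))
  Y-equation =
    ≈-trans (S-equation (+ 1) (- (b * b)))
            (⊕-cong (≈-refl {𝟏}) (⊛-congʳ z (⊕-cong (≈-refl {𝟏 ⊛ Y})
              (⊛-congˡ (Y ⊛ Y) (≈-trans (const-neg (b * b)) (⊝-cong (const-⊛-const b b)))))))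

  -- Multiplying by A (which is invertible) turns the equation of V into that of Y.
  A⊛V-equation : A ⊛ V ≈ 𝟏 ⊕ z ⊛ (𝟏 ⊛ (A ⊛ V) ⊕ ⊝ (B ⊛ B) ⊛ ((A ⊛ V) ⊛ (A ⊛ V)))
  A⊛V-equation =
    ≈-sym (difference-≈𝟎⇒≈ _ (A ⊛ V)
      (⊛-cancelˡ-1+z A (𝟏 ⊛ A ⊕ B ⊛ (A ⊛ A)) _ A-equation
        (≈-trans (identity A V z B)
          (≈-trans (⊕-cong (⊝-cong (⊛-congʳ A (difference-≈𝟎 V-equation)))
                           (⊝-cong (⊛-congʳ (A ⊛ V) (difference-≈𝟎 A-equation))))
                   (λ n → cong₂ (λ x y → - x + - y) (⊛-zeroʳ A n) (⊛-zeroʳ (A ⊛ V) n))))))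
    where
    identity : ∀ a v z b →
      a ⊛ ((𝟏 ⊕ z ⊛ (𝟏 ⊛ (a ⊛ v) ⊕ ⊝ (b ⊛ b) ⊛ ((a ⊛ v) ⊛ (a ⊛ v)))) ⊕ ⊝ (a ⊛ v))
        ≈ ⊝ (a ⊛ (v ⊕ ⊝ (𝟏 ⊕ z ⊛ ((⊝ b ⊛ (a ⊛ (a ⊛ 𝟏))) ⊛ v
                                   ⊕ (⊝ (b ⊛ b) ⊛ (a ⊛ (a ⊛ 𝟏))) ⊛ (v ⊛ v)))))
          ⊕ ⊝ ((a ⊛ v) ⊛ (a ⊕ ⊝ (𝟏 ⊕ z ⊛ (𝟏 ⊛ a ⊕ b ⊛ (a ⊛ a)))))
    identity = solve 4 (λ a v z b →
      a :* ((con (+ 1) :+ z :* (con (+ 1) :* (a :* v) :+ :- (b :* b) :* ((a :* v) :* (a :* v)))) :+ :- (a :* v))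
        := :- (a :* (v :+ :- (con (+ 1) :+ z :* ((:- b :* (a :* (a :* con (+ 1)))) :* v
                                                 :+ (:- (b :* b) :* (a :* (a :* con (+ 1)))) :* (v :* v)))))
           :+ :- ((a :* v) :* (a :+ :- (con (+ 1) :+ z :* (con (+ 1) :* a :+ b :* (a :* a))))))
      ≈-refl

  A⊛V≈Y : A ⊛ V ≈ Y
  A⊛V≈Y = quadratic-unique 𝟏 (⊝ (B ⊛ B)) (A ⊛ V) Y A⊛V-equation Y-equation

  V≈Y-via-A : V ≈ Y ⊕ ⊝ (z ⊛ Y) ⊕ ⊝ (B ⊛ (z ⊛ (A ⊛ Y)))
  V≈Y-via-A =
    difference-≈𝟎⇒≈ V _
      (⊛-cancelˡ-1+z A (𝟏 ⊛ A ⊕ B ⊛ (A ⊛ A)) _ A-equation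
        (≈-trans (identity A V Y z B)
          (≈-trans (⊕-cong (difference-≈𝟎 A⊛V≈Y) (⊝-cong (⊛-congʳ Y (difference-≈𝟎 A-equation))))
                   (λ n → cong (λ x → + 0 + - x) (⊛-zeroʳ Y n)))))
    where
    identity : ∀ a v y z b →
      a ⊛ (v ⊕ ⊝ (y ⊕ ⊝ (z ⊛ y) ⊕ ⊝ (b ⊛ (z ⊛ (a ⊛ y)))))
        ≈ (a ⊛ v ⊕ ⊝ y) ⊕ ⊝ (y ⊛ (a ⊕ ⊝ (𝟏 ⊕ z ⊛ (𝟏 ⊛ a ⊕ b ⊛ (a ⊛ a)))))
    identity = solve 5 (λ a v y z b →
      a :* (v :+ :- (y :+ :- (z :* y) :+ :- (b :* (z :* (a :* y)))))
        := (a :* v :+ :- y) :+ :- (y :* (a :+ :- (con (+ 1) :+ z :* (con (+ 1) :* a :+ b :* (a :* a))))))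
      ≈-refl

  sum-A-G : ∀ n → sum≤ n (λ ℓ → A ℓ * G ℓ 2 n) ≡ (A ⊛ Y) n
  sum-A-G n =
    trans (sum≤-cong n (λ ℓ → cong (_* G ℓ 2 n) (sym (⊛-identityʳ A ℓ))))
          (≈-trans (H-factor 1 2) (≈-trans (reassoc A V) (⊛-congʳ A A⊛V≈Y)) n)
    where
    reassoc : ∀ a v → (a ⊛ (a ⊛ 𝟏)) ⊛ v ≈ a ⊛ (a ⊛ v)
    reassoc = solve 2 (λ a v → (a :* (a :* con (+ 1))) :* v := a :* (a :* v)) ≈-refl

  sum-A-suc-G : ∀ n → - b * sum≤ n (λ ℓ → A (suc ℓ) * G ℓ 2 n) ≡ Y (suc n) + - Y n + - (b * (A ⊛ Y) n)
  sum-A-suc-G n =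
    trans (sym V-coeff)
          (trans (V≈Y-via-A (suc n))
                 (cong₂ (λ x y → Y (suc n) + - x + - y) (z⊛-suc Y n)
                        (trans (const-⊛ b (z ⊛ (A ⊛ Y)) (suc n)) (cong (_*_ b) (z⊛-suc (A ⊛ Y) n)))))
    where
    swap : ∀ a c g → a * (c * g) ≡ c * (a * g)
    swap = solve-∀
    V-coeff : V (suc n) ≡ - b * sum≤ n (λ ℓ → A (suc ℓ) * G ℓ 2 n)
    V-coeff =
      trans (cong₂ _+_ (trans (cong (_*_ ((A ^ₛ 1) 0)) (G-zero 0 (suc n))) (ℤ.*-zeroʳ ((A ^ₛ 1) 0)))
                       (trans (sum≤-cong n (λ ℓ → cong₂ _*_ (⊛-identityʳ A (suc ℓ)) (G-suc-coeff ℓ 0 n)))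
                              (trans (sum≤-cong n (λ ℓ → swap (A (suc ℓ)) (- b) (G ℓ 2 n)))
                                     (sum≤-*ˡ n (- b) _))))
            (ℤ.+-identityˡ _)

  A-defect : Series
  A-defect = A ⊕ ⊝ (𝟏 ⊕ z ⊛ (𝟏 ⊛ A ⊕ B ⊛ (A ⊛ A)))

  A-defect≈𝟎 : A-defect ≈ 𝟎
  A-defect≈𝟎 = difference-≈𝟎 A-equation

module PathCounting (r′ : ℕ) where

  open import Data.Nat as ℕ using (zero; suc; _∸_; _≡ᵇ_)
  open import Data.Nat.Properties as ℕ using ()
  open import Data.Integer using (ℤ; +_; -_; _+_; _*_; _^_)
  open import Data.Integer.Properties as ℤ using ()
  open import Data.Integer.Tactic.RingSolver using (solve-∀)
  import Data.Nat.Tactic.RingSolver as ℕ-Solver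
  open import Data.Bool using (Bool; true; false; not; _∧_; if_then_else_)
  open import Data.Fin using (Fin)
  open import Data.Fin.Properties using (_≟_)
  open import Data.List using (List; []; _∷_; map; allFin)
  open import Data.Nat.ListAction using (sum)
  open import Data.Maybe using (Maybe; just; nothing)
  open import Function using (_∘_)
  open import Relation.Nullary.Decidable using (⌊_⌋)
  open import Relation.Binary.PropositionalEquality
  open import Defs using (Step; u; d; words; dyckFrom; noSameDD; peaksFrom; peaksAtLevel; filterB; p)
  open PowerSeries
  open ListSum
  open SchröderSeries using (^-distrib-*)
  open Substitution (+ r′)

  r : ℕ
  r = suc r′

  R : Series
  R = 𝟏 ⊕ B

  R⊛ : ∀ f → R ⊛ f ≈ scale (+ r) f
  R⊛ f n = trans (⊛-distribʳ 𝟏 B f n) (trans (cong₂ _+_ (⊛-identityˡ f n) (const-⊛ (+ r′) f n)) (collect (+ r′) (f n)))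
    where
    collect : ∀ b x → x + b * x ≡ (+ 1 + b) * x
    collect = solve-∀

  -- heightCoeff X h m reads X as the series of paths of length m from height h down
  -- to 0, so it is X at (m - h)/2, and 0 when m - h is negative or odd.
  heightCoeff : Series → ℕ → ℕ → ℤ
  heightCoeff X zero    zero          = X 0
  heightCoeff X zero    (suc zero)    = + 0
  heightCoeff X zero    (suc (suc m)) = heightCoeff (tail X) zero m
  heightCoeff X (suc h) zero          = + 0
  heightCoeff X (suc h) (suc m)       = heightCoeff X h m

  heightCoeff-cong : ∀ {X Y} → X ≈ Y → ∀ h m → heightCoeff X h m ≡ heightCoeff Y h m
  heightCoeff-cong e zero    zero          = e 0
  heightCoeff-cong e zero    (suc zero)    = refl
  heightCoeff-cong e zero    (suc (suc m)) = heightCoeff-cong (e ∘ suc) zero m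
  heightCoeff-cong e (suc h) zero          = refl
  heightCoeff-cong e (suc h) (suc m)       = heightCoeff-cong e h m

  heightCoeff-⊕ : ∀ X Y h m → heightCoeff (X ⊕ Y) h m ≡ heightCoeff X h m + heightCoeff Y h m
  heightCoeff-⊕ X Y zero    zero          = refl
  heightCoeff-⊕ X Y zero    (suc zero)    = refl
  heightCoeff-⊕ X Y zero    (suc (suc m)) = heightCoeff-⊕ (tail X) (tail Y) zero m
  heightCoeff-⊕ X Y (suc h) zero          = refl
  heightCoeff-⊕ X Y (suc h) (suc m)       = heightCoeff-⊕ X Y h m

  heightCoeff-scale : ∀ c X h m → heightCoeff (scale c X) h m ≡ c * heightCoeff X h m
  heightCoeff-scale c X zero    zero          = refl
  heightCoeff-scale c X zero    (suc zero)    = sym (ℤ.*-zeroʳ c)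
  heightCoeff-scale c X zero    (suc (suc m)) = heightCoeff-scale c (tail X) zero m
  heightCoeff-scale c X (suc h) zero          = sym (ℤ.*-zeroʳ c)
  heightCoeff-scale c X (suc h) (suc m)       = heightCoeff-scale c X h m

  heightCoeff-const⊛ : ∀ c X h m → heightCoeff (const c ⊛ X) h m ≡ c * heightCoeff X h m
  heightCoeff-const⊛ c X h m = trans (heightCoeff-cong (const-⊛ c X) h m) (heightCoeff-scale c X h m)

  heightCoeff-zero : ∀ X h m → X ≈ 𝟎 → heightCoeff X h m ≡ + 0
  heightCoeff-zero X h m e = trans (heightCoeff-cong e h m) (zero-coeff h m)
    where
    zero-coeff : ∀ h m → heightCoeff 𝟎 h m ≡ + 0
    zero-coeff zero    zero          = refl
    zero-coeff zero    (suc zero)    = refl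
    zero-coeff zero    (suc (suc m)) = zero-coeff zero m
    zero-coeff (suc h) zero          = refl
    zero-coeff (suc h) (suc m)       = zero-coeff h m

  heightCoeff-z⊛ : ∀ X h m → heightCoeff (z ⊛ X) h (suc m) ≡ heightCoeff X (suc h) m
  heightCoeff-z⊛ X zero          zero    = refl
  heightCoeff-z⊛ X zero          (suc m) = heightCoeff-cong (z⊛-suc X) zero m
  heightCoeff-z⊛ X (suc zero)    zero    = refl
  heightCoeff-z⊛ X (suc (suc h)) zero    = refl
  heightCoeff-z⊛ X (suc h)       (suc m) = heightCoeff-z⊛ X h m

  heightCoeff-1+z⊛ : ∀ X m → heightCoeff (𝟏 ⊕ z ⊛ X) 0 (suc m) ≡ heightCoeff X 1 m
  heightCoeff-1+z⊛ X m =
    trans (heightCoeff-⊕ 𝟏 (z ⊛ X) 0 (suc m))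
          (trans (cong₂ _+_ (𝟏-odd m) (heightCoeff-z⊛ X 0 m))
                 (ℤ.+-identityˡ _))
    where
    𝟏-odd : ∀ m → heightCoeff 𝟏 0 (suc m) ≡ + 0
    𝟏-odd zero    = refl
    𝟏-odd (suc m) = heightCoeff-zero (tail 𝟏) 0 m (λ _ → refl)

  heightCoeff-even : ∀ X k → heightCoeff X 0 (k ℕ.+ k) ≡ X k
  heightCoeff-even X zero    = refl
  heightCoeff-even X (suc k) = trans (cong (heightCoeff X 0 ∘ suc) (ℕ.+-suc k k)) (heightCoeff-even (tail X) k)

  -- admissible prev h w: w is the rest of a path of 𝒜⁽ʳ⁾ that has reached height h,
  -- the step before w being a d-step of colour c when prev = just c.
  admissible : Maybe (Fin r) → ℕ → List (Step r) → Bool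
  admissible nothing  h w = dyckFrom h w ∧ noSameDD w
  admissible (just c) h w = dyckFrom h w ∧ noSameDD (d c ∷ w)

  compatible : Maybe (Fin r) → Fin r → Bool
  compatible nothing  c′ = true
  compatible (just c) c′ = not ⌊ c ≟ c′ ⌋

  multiplicity : Maybe (Fin r) → ℤ
  multiplicity nothing  = + r
  multiplicity (just _) = + r′

  multSeries : Maybe (Fin r) → Series
  multSeries nothing  = R
  multSeries (just _) = B

  heightCoeff-multSeries : ∀ prev X h m →
    heightCoeff (multSeries prev ⊛ X) h m ≡ multiplicity prev * heightCoeff X h m
  heightCoeff-multSeries nothing  X h m = trans (heightCoeff-cong (R⊛ X) h m) (heightCoeff-scale (+ r) X h m)
  heightCoeff-multSeries (just _) X h m = heightCoeff-const⊛ (+ r′) X h m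

  sum-compatible : ∀ prev (f : Fin r → ℤ) K → (∀ c → f c ≡ K) →
    sumL (λ c → 𝟙 (compatible prev c) * f c) (allFin r) ≡ multiplicity prev * K
  sum-compatible nothing  f K e = sumL-allFin-const r _ K (λ c → trans (ℤ.*-identityˡ (f c)) (e c))
  sum-compatible (just c) f K e = sumL-allFin-≢ r c f K e

  admissible-u : ∀ prev h w → admissible prev h (u ∷ w) ≡ admissible nothing (suc h) w
  admissible-u nothing  h w = refl
  admissible-u (just c) h w = refl

  admissible-d-zero : ∀ prev c w → admissible prev 0 (d c ∷ w) ≡ false
  admissible-d-zero nothing  c w = refl
  admissible-d-zero (just _) c w = refl

  𝟙-admissible-d : ∀ prev h c w →
    𝟙 (admissible prev (suc h) (d c ∷ w)) ≡ 𝟙 (compatible prev c) * 𝟙 (admissible (just c) h w)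
  𝟙-admissible-d nothing   h c w = sym (ℤ.*-identityˡ _)
  𝟙-admissible-d (just c₀) h c w = 𝟙-∧-middle (dyckFrom h w) (not ⌊ c₀ ≟ c ⌋) (noSameDD (d c ∷ w))
    where
    𝟙-∧-middle : ∀ x y v → 𝟙 (x ∧ (y ∧ v)) ≡ 𝟙 y * 𝟙 (x ∧ v)
    𝟙-∧-middle false y     v = sym (ℤ.*-zeroʳ (𝟙 y))
    𝟙-∧-middle true  false v = refl
    𝟙-∧-middle true  true  v = sym (ℤ.*-identityˡ (𝟙 v))

  first-step : ∀ m (g : List (Step r) → ℤ) →
    sumL g (words r (suc m))
      ≡ sumL (λ w → g (u ∷ w)) (words r m) + sumL (λ w → sumL (λ c → g (d c ∷ w)) (allFin r)) (words r m)
  first-step m g =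
    trans (sumL-concatMap g (λ w → map (_∷ w) (u ∷ map d (allFin r))) (words r m))
          (trans (sumL-cong (words r m) (λ w → cong (_+_ (g (u ∷ w)))
                   (trans (sumL-map g (_∷ w) (map d (allFin r))) (sumL-map (λ s → g (s ∷ w)) d (allFin r)))))
                 (sumL-distrib-+ (λ w → g (u ∷ w)) _ (words r m)))

  admissibleTotal : (ℕ → List (Step r) → ℤ) → Maybe (Fin r) → ℕ → ℕ → ℤ
  admissibleTotal ω prev h m = sumL (λ w → 𝟙 (admissible prev h w) * ω h w) (words r m)

  downTotal : (ℕ → List (Step r) → ℤ) → Maybe (Fin r) → ℕ → ℕ → ℤ
  downTotal ω prev h m =
    sumL (λ w → sumL (λ c → 𝟙 (admissible prev h (d c ∷ w)) * ω h (d c ∷ w)) (allFin r)) (words r m)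

  admissibleTotal-suc : ∀ ω prev h m →
    admissibleTotal ω prev h (suc m)
      ≡ sumL (λ w → 𝟙 (admissible nothing (suc h) w) * ω h (u ∷ w)) (words r m) + downTotal ω prev h m
  admissibleTotal-suc ω prev h m =
    trans (first-step m (λ w → 𝟙 (admissible prev h w) * ω h w))
          (cong (_+ downTotal ω prev h m)
                (sumL-cong (words r m) (λ w → cong (λ t → 𝟙 t * ω h (u ∷ w)) (admissible-u prev h w))))

  downTotal-zero : ∀ ω prev m → downTotal ω prev 0 m ≡ + 0
  downTotal-zero ω prev m =
    sumL-zero (λ w → sumL (λ c → 𝟙 (admissible prev 0 (d c ∷ w)) * ω 0 (d c ∷ w)) (allFin r)) (words r m)
      (λ w → sumL-zero (λ c → 𝟙 (admissible prev 0 (d c ∷ w)) * ω 0 (d c ∷ w)) (allFin r) (λ c →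
      cong (λ t → 𝟙 t * ω 0 (d c ∷ w)) (admissible-d-zero prev c w)))

  downTotal-suc : ∀ ω ω′ → (∀ h c w → ω (suc h) (d c ∷ w) ≡ ω′ h w) → ∀ prev h m K →
    (∀ c → admissibleTotal ω′ (just c) h m ≡ K) →
    downTotal ω prev (suc h) m ≡ multiplicity prev * K
  downTotal-suc ω ω′ ω-d prev h m K e =
    begin
      sumL (λ w → sumL (λ c → 𝟙 (admissible prev (suc h) (d c ∷ w)) * ω (suc h) (d c ∷ w)) (allFin r)) (words r m)
    ≡⟨ sumL-cong (words r m) (λ w → sumL-cong (allFin r) (λ c → split c w)) ⟩
      sumL (λ w → sumL (λ c → 𝟙 (compatible prev c) * (𝟙 (admissible (just c) h w) * ω′ h w)) (allFin r)) (words r m)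
    ≡⟨ sumL-swap (λ w c → 𝟙 (compatible prev c) * (𝟙 (admissible (just c) h w) * ω′ h w)) (words r m) (allFin r) ⟩
      sumL (λ c → sumL (λ w → 𝟙 (compatible prev c) * (𝟙 (admissible (just c) h w) * ω′ h w)) (words r m)) (allFin r)
    ≡⟨ sumL-cong (allFin r) (λ c →
         sumL-*ˡ (𝟙 (compatible prev c)) (λ w → 𝟙 (admissible (just c) h w) * ω′ h w) (words r m)) ⟩
      sumL (λ c → 𝟙 (compatible prev c) * admissibleTotal ω′ (just c) h m) (allFin r)
    ≡⟨ sum-compatible prev (λ c → admissibleTotal ω′ (just c) h m) K e ⟩
      multiplicity prev * K
    ∎
    where
    open ≡-Reasoning
    split : ∀ c w → 𝟙 (admissible prev (suc h) (d c ∷ w)) * ω (suc h) (d c ∷ w)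
                  ≡ 𝟙 (compatible prev c) * (𝟙 (admissible (just c) h w) * ω′ h w)
    split c w = trans (cong₂ _*_ (𝟙-admissible-d prev h c w) (ω-d h c w))
                      (ℤ.*-assoc (𝟙 (compatible prev c)) (𝟙 (admissible (just c) h w)) (ω′ h w))

  count : Maybe (Fin r) → ℕ → ℕ → ℤ
  count = admissibleTotal (λ _ _ → + 1)

  downSeries : ℕ → Series
  downSeries h = B ^ₛ h ⊛ A ^ₛ suc h

  pathSeries : Maybe (Fin r) → ℕ → Series
  pathSeries nothing  zero    = A
  pathSeries nothing  (suc h) = (𝟏 ⊕ B ⊛ A) ⊛ downSeries h
  pathSeries (just _) h       = downSeries h

  pathSeries-zero : ∀ prev → pathSeries prev 0 ≈ 𝟏 ⊕ z ⊛ pathSeries nothing 1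
  pathSeries-zero nothing  = ≈-modulo _ _ 𝟏 A-defect (identity A z B) A-defect≈𝟎
    where
    identity : ∀ a z b → a ⊕ ⊝ (𝟏 ⊕ z ⊛ ((𝟏 ⊕ b ⊛ a) ⊛ (𝟏 ⊛ (a ⊛ 𝟏))))
                           ≈ 𝟏 ⊛ (a ⊕ ⊝ (𝟏 ⊕ z ⊛ (𝟏 ⊛ a ⊕ b ⊛ (a ⊛ a))))
    identity = solve 3 (λ a z b →
      a :+ :- (con (+ 1) :+ z :* ((con (+ 1) :+ b :* a) :* (con (+ 1) :* (a :* con (+ 1)))))
        := con (+ 1) :* (a :+ :- (con (+ 1) :+ z :* (con (+ 1) :* a :+ b :* (a :* a)))))
      ≈-refl
  pathSeries-zero (just _) = ≈-modulo _ _ 𝟏 A-defect (identity A z B) A-defect≈𝟎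
    where
    identity : ∀ a z b → 𝟏 ⊛ (a ⊛ 𝟏) ⊕ ⊝ (𝟏 ⊕ z ⊛ ((𝟏 ⊕ b ⊛ a) ⊛ (𝟏 ⊛ (a ⊛ 𝟏))))
                           ≈ 𝟏 ⊛ (a ⊕ ⊝ (𝟏 ⊕ z ⊛ (𝟏 ⊛ a ⊕ b ⊛ (a ⊛ a))))
    identity = solve 3 (λ a z b →
      con (+ 1) :* (a :* con (+ 1)) :+ :- (con (+ 1) :+ z :* ((con (+ 1) :+ b :* a) :* (con (+ 1) :* (a :* con (+ 1)))))
        := con (+ 1) :* (a :+ :- (con (+ 1) :+ z :* (con (+ 1) :* a :+ b :* (a :* a)))))
      ≈-refl

  pathSeries-suc : ∀ prev h →
    pathSeries prev (suc h) ≈ z ⊛ pathSeries nothing (suc (suc h)) ⊕ multSeries prev ⊛ downSeries h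
  pathSeries-suc nothing  h =
    ≈-modulo _ _ (B ⊛ B ^ₛ h ⊛ A ⊛ A ^ₛ h) A-defect (identity A z B (B ^ₛ h) (A ^ₛ h)) A-defect≈𝟎
    where
    identity : ∀ a z b c p →
      (𝟏 ⊕ b ⊛ a) ⊛ (c ⊛ (a ⊛ p))
        ⊕ ⊝ (z ⊛ ((𝟏 ⊕ b ⊛ a) ⊛ ((b ⊛ c) ⊛ (a ⊛ (a ⊛ p)))) ⊕ (𝟏 ⊕ b) ⊛ (c ⊛ (a ⊛ p)))
        ≈ (b ⊛ c ⊛ a ⊛ p) ⊛ (a ⊕ ⊝ (𝟏 ⊕ z ⊛ (𝟏 ⊛ a ⊕ b ⊛ (a ⊛ a))))
    identity = solve 5 (λ a z b c p →
      (con (+ 1) :+ b :* a) :* (c :* (a :* p))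
        :+ :- (z :* ((con (+ 1) :+ b :* a) :* ((b :* c) :* (a :* (a :* p)))) :+ (con (+ 1) :+ b) :* (c :* (a :* p)))
        := (b :* c :* a :* p) :* (a :+ :- (con (+ 1) :+ z :* (con (+ 1) :* a :+ b :* (a :* a)))))
      ≈-refl
  pathSeries-suc (just _) h =
    ≈-modulo _ _ (B ⊛ B ^ₛ h ⊛ A ⊛ A ^ₛ h) A-defect (identity A z B (B ^ₛ h) (A ^ₛ h)) A-defect≈𝟎
    where
    identity : ∀ a z b c p →
      (b ⊛ c) ⊛ (a ⊛ (a ⊛ p)) ⊕ ⊝ (z ⊛ ((𝟏 ⊕ b ⊛ a) ⊛ ((b ⊛ c) ⊛ (a ⊛ (a ⊛ p)))) ⊕ b ⊛ (c ⊛ (a ⊛ p)))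
        ≈ (b ⊛ c ⊛ a ⊛ p) ⊛ (a ⊕ ⊝ (𝟏 ⊕ z ⊛ (𝟏 ⊛ a ⊕ b ⊛ (a ⊛ a))))
    identity = solve 5 (λ a z b c p →
      (b :* c) :* (a :* (a :* p))
        :+ :- (z :* ((con (+ 1) :+ b :* a) :* ((b :* c) :* (a :* (a :* p)))) :+ b :* (c :* (a :* p)))
        := (b :* c :* a :* p) :* (a :+ :- (con (+ 1) :+ z :* (con (+ 1) :* a :+ b :* (a :* a)))))
      ≈-refl

  count-series : ∀ m prev h → count prev h m ≡ heightCoeff (pathSeries prev h) h m
  count-series zero    nothing  zero    = sym A-head
  count-series zero    (just _) zero    = cong (λ a → + 1 * (a * + 1)) (sym A-head)
  count-series zero    nothing  (suc h) = refl
  count-series zero    (just _) (suc h) = refl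
  count-series (suc m) prev     zero    =
    begin
      count prev 0 (suc m)
    ≡⟨ admissibleTotal-suc (λ _ _ → + 1) prev 0 m ⟩
      count nothing 1 m + downTotal (λ _ _ → + 1) prev 0 m
    ≡⟨ cong₂ _+_ (count-series m nothing 1) (downTotal-zero (λ _ _ → + 1) prev m) ⟩
      heightCoeff (pathSeries nothing 1) 1 m + + 0
    ≡⟨ ℤ.+-identityʳ _ ⟩
      heightCoeff (pathSeries nothing 1) 1 m
    ≡⟨ heightCoeff-1+z⊛ (pathSeries nothing 1) m ⟨
      heightCoeff (𝟏 ⊕ z ⊛ pathSeries nothing 1) 0 (suc m)
    ≡⟨ heightCoeff-cong (pathSeries-zero prev) 0 (suc m) ⟨
      heightCoeff (pathSeries prev 0) 0 (suc m)
    ∎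
    where open ≡-Reasoning
  count-series (suc m) prev     (suc h) =
    begin
      count prev (suc h) (suc m)
    ≡⟨ admissibleTotal-suc (λ _ _ → + 1) prev (suc h) m ⟩
      count nothing (suc (suc h)) m + downTotal (λ _ _ → + 1) prev (suc h) m
    ≡⟨ cong₂ _+_ (count-series m nothing (suc (suc h)))
                 (downTotal-suc (λ _ _ → + 1) (λ _ _ → + 1) (λ _ _ _ → refl) prev h m _ (λ c → count-series m (just c) h)) ⟩
      heightCoeff (pathSeries nothing (suc (suc h))) (suc (suc h)) m + multiplicity prev * heightCoeff (downSeries h) h m
    ≡⟨ cong₂ _+_ (heightCoeff-z⊛ (pathSeries nothing (suc (suc h))) (suc h) m)
                 (heightCoeff-multSeries prev (downSeries h) (suc h) (suc m)) ⟨
      heightCoeff (z ⊛ pathSeries nothing (suc (suc h))) (suc h) (suc m) + heightCoeff (multSeries prev ⊛ downSeries h) (suc h) (suc m)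
    ≡⟨ heightCoeff-⊕ (z ⊛ pathSeries nothing (suc (suc h))) (multSeries prev ⊛ downSeries h) (suc h) (suc m) ⟨
      heightCoeff (z ⊛ pathSeries nothing (suc (suc h)) ⊕ multSeries prev ⊛ downSeries h) (suc h) (suc m)
    ≡⟨ heightCoeff-cong (pathSeries-suc prev h) (suc h) (suc m) ⟨
      heightCoeff (pathSeries prev (suc h)) (suc h) (suc m)
    ∎
    where open ≡-Reasoning

  levelSeries : ℕ → Series
  levelSeries zero    = 𝟎
  levelSeries (suc ℓ) = z ⊛ (R ⊛ (B ^ₛ ℓ ⊛ (z ^ₛ ℓ ⊛ A ^ₛ (ℓ ℕ.+ ℓ ℕ.+ 2))))

  levelSeries-head : ∀ j → levelSeries j 0 ≡ + 0
  levelSeries-head zero    = refl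
  levelSeries-head (suc j) = refl

  levelSeries-vanish : 𝟎 ≈ z ⊛ ((A ⊛ A) ⊛ (const (+ 0) ⊛ R ⊕ B ⊛ 𝟎))
  levelSeries-vanish =
    ≈-sym (≈-trans (⊛-congʳ z (≈-trans (⊛-congʳ (A ⊛ A) inner) (⊛-zeroʳ (A ⊛ A)))) (⊛-zeroʳ z))
    where
    inner : const (+ 0) ⊛ R ⊕ B ⊛ 𝟎 ≈ 𝟎
    inner n = cong₂ _+_ (const-⊛ (+ 0) R n) (⊛-zeroʳ B n)

  levelSeries-step : ∀ j → levelSeries (suc j) ≈ z ⊛ ((A ⊛ A) ⊛ (const (𝟙 (0 ≡ᵇ j)) ⊛ R ⊕ B ⊛ levelSeries j))
  levelSeries-step zero    =
    ≈-trans (regroup A z B)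
            (⊛-congʳ z (⊛-congʳ (A ⊛ A) unit))
    where
    unit : 𝟏 ⊛ R ≈ const (+ 1) ⊛ R ⊕ B ⊛ 𝟎
    unit n = sym (trans (cong (_+_ ((𝟏 ⊛ R) n)) (⊛-zeroʳ B n)) (ℤ.+-identityʳ _))
    regroup : ∀ a z b →
      z ⊛ ((𝟏 ⊕ b) ⊛ (𝟏 ⊛ (𝟏 ⊛ (a ⊛ (a ⊛ 𝟏))))) ≈ z ⊛ ((a ⊛ a) ⊛ (𝟏 ⊛ (𝟏 ⊕ b)))
    regroup = solve 3 (λ a z b →
      z :* ((con (+ 1) :+ b) :* (con (+ 1) :* (con (+ 1) :* (a :* (a :* con (+ 1))))))
        := z :* ((a :* a) :* (con (+ 1) :* (con (+ 1) :+ b))))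
      ≈-refl
  levelSeries-step (suc j) =
    ≈-trans (⊛-congʳ z (⊛-congʳ R (⊛-congʳ (B ^ₛ suc j) (⊛-congʳ (z ^ₛ suc j) (^ₛ-≡ A (index j))))))
            (regroup A z B (B ^ₛ j) (z ^ₛ j) (A ^ₛ (j ℕ.+ j ℕ.+ 2)))
    where
    index : ∀ j → suc j ℕ.+ suc j ℕ.+ 2 ≡ suc (suc (j ℕ.+ j ℕ.+ 2))
    index = ℕ-Solver.solve-∀
    regroup : ∀ a z b c w p →
      z ⊛ ((𝟏 ⊕ b) ⊛ ((b ⊛ c) ⊛ ((z ⊛ w) ⊛ (a ⊛ (a ⊛ p)))))
        ≈ z ⊛ ((a ⊛ a) ⊛ (const (+ 0) ⊛ (𝟏 ⊕ b) ⊕ b ⊛ (z ⊛ ((𝟏 ⊕ b) ⊛ (c ⊛ (w ⊛ p))))))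
    regroup = solve 6 (λ a z b c w p →
      z :* ((con (+ 1) :+ b) :* ((b :* c) :* ((z :* w) :* (a :* (a :* p)))))
        := z :* ((a :* a) :* (con (+ 0) :* (con (+ 1) :+ b) :+ b :* (z :* ((con (+ 1) :+ b) :* (c :* (w :* p)))))))
      ≈-refl

  levelSeries-∸ : ∀ L h →
    levelSeries (L ∸ h) ≈ z ⊛ ((A ⊛ A) ⊛ (const (𝟙 (suc h ≡ᵇ L)) ⊛ R ⊕ B ⊛ levelSeries (L ∸ suc h)))
  levelSeries-∸ zero    zero    = levelSeries-vanish
  levelSeries-∸ zero    (suc h) = levelSeries-vanish
  levelSeries-∸ (suc L) zero    = levelSeries-step L
  levelSeries-∸ (suc L) (suc h) = levelSeries-∸ L h

  module AtLevel (L : ℕ) where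

    peaks : ℕ → List (Step r) → ℤ
    peaks h w = + peaksFrom L h w

    startsDown : List (Step r) → ℤ
    startsDown []        = + 0
    startsDown (u ∷ _)   = + 0
    startsDown (d _ ∷ _) = + 1

    peaks-u : ∀ h w → peaks h (u ∷ w) ≡ 𝟙 (suc h ≡ᵇ L) * startsDown w + peaks (suc h) w
    peaks-u h []        = sym (cong (_+ + 0) (ℤ.*-zeroʳ (𝟙 (suc h ≡ᵇ L))))
    peaks-u h (u ∷ w)   = sym (trans (cong (_+ peaks (suc h) (u ∷ w)) (ℤ.*-zeroʳ (𝟙 (suc h ≡ᵇ L)))) (ℤ.+-identityˡ _))
    peaks-u h (d c ∷ w) =
      trans (ℤ.pos-+ (if suc h ≡ᵇ L then 1 else 0) (peaksFrom L (suc h) (d c ∷ w)))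
            (cong (_+ peaks (suc h) (d c ∷ w)) (indicator (suc h ≡ᵇ L)))
      where
      indicator : ∀ β → + (if β then 1 else 0) ≡ 𝟙 β * + 1
      indicator true  = refl
      indicator false = refl

    startsDown-total : ∀ h m → admissibleTotal (λ _ → startsDown) nothing (suc h) m ≡ + r * heightCoeff (downSeries h) (suc h) m
    startsDown-total h zero    = sym (ℤ.*-zeroʳ (+ r))
    startsDown-total h (suc m) =
      trans (admissibleTotal-suc (λ _ → startsDown) nothing (suc h) m)
            (trans (cong₂ _+_ (sumL-zero _ (words r m) (λ w → ℤ.*-zeroʳ (𝟙 (admissible nothing (suc (suc h)) w))))
                              (downTotal-suc (λ _ → startsDown) (λ _ _ → + 1) (λ _ _ _ → refl) nothing h m _
                                             (λ c → count-series m (just c) h)))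
                   (ℤ.+-identityˡ _))

    levelAbove : ℕ → Series
    levelAbove h = levelSeries (L ∸ h)

    levelAboveSum : ℕ → Series
    levelAboveSum zero    = levelAbove 0
    levelAboveSum (suc h) = levelAboveSum h ⊕ levelAbove (suc h)

    peakDownSeries : ℕ → Series
    peakDownSeries h = B ^ₛ h ⊛ (A ^ₛ h ⊛ levelAboveSum h)

    peakSeries : Maybe (Fin r) → ℕ → Series
    peakSeries nothing  zero    = peakDownSeries 0
    peakSeries nothing  (suc h) = (𝟏 ⊕ B ⊛ A) ⊛ peakDownSeries h ⊕ B ⊛ (levelAbove (suc h) ⊛ downSeries h)
    peakSeries (just _) h       = peakDownSeries h

    upSeries : ℕ → Series
    upSeries h = const (𝟙 (suc h ≡ᵇ L)) ⊛ (R ⊛ downSeries h) ⊕ peakSeries nothing (suc h)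

    levelAbove-defect : ℕ → Series
    levelAbove-defect h =
      levelAbove h ⊕ ⊝ (z ⊛ ((A ⊛ A) ⊛ (const (𝟙 (suc h ≡ᵇ L)) ⊛ R ⊕ B ⊛ levelAbove (suc h))))

    levelAbove-defect≈𝟎 : ∀ h → levelAbove-defect h ≈ 𝟎
    levelAbove-defect≈𝟎 h = difference-≈𝟎 (levelSeries-∸ L h)

    peakDownSeries-zero : peakDownSeries 0 ≈ z ⊛ upSeries 0
    peakDownSeries-zero =
      ≈-modulo₂ _ _ (𝟏 ⊕ ⊝ z ⊕ ⊝ (z ⊛ (B ⊛ A))) (levelAbove-defect 0)
                    (z ⊛ (A ⊛ (const (𝟙 (1 ≡ᵇ L)) ⊛ R ⊕ B ⊛ levelAbove 1))) A-defect
                    (identity A z B (const (𝟙 (1 ≡ᵇ L))) (levelAbove 0) (levelAbove 1))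
                    (levelAbove-defect≈𝟎 0) A-defect≈𝟎
      where
      identity : ∀ a z b ι q₀ q₁ →
        𝟏 ⊛ (𝟏 ⊛ q₀)
          ⊕ ⊝ (z ⊛ (ι ⊛ ((𝟏 ⊕ b) ⊛ (𝟏 ⊛ (a ⊛ 𝟏)))
                    ⊕ ((𝟏 ⊕ b ⊛ a) ⊛ (𝟏 ⊛ (𝟏 ⊛ q₀)) ⊕ b ⊛ (q₁ ⊛ (𝟏 ⊛ (a ⊛ 𝟏))))))
          ≈ (𝟏 ⊕ ⊝ z ⊕ ⊝ (z ⊛ (b ⊛ a))) ⊛ (q₀ ⊕ ⊝ (z ⊛ ((a ⊛ a) ⊛ (ι ⊛ (𝟏 ⊕ b) ⊕ b ⊛ q₁))))
            ⊕ (z ⊛ (a ⊛ (ι ⊛ (𝟏 ⊕ b) ⊕ b ⊛ q₁))) ⊛ (a ⊕ ⊝ (𝟏 ⊕ z ⊛ (𝟏 ⊛ a ⊕ b ⊛ (a ⊛ a))))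
      identity = solve 6 (λ a z b ι q₀ q₁ →
        con (+ 1) :* (con (+ 1) :* q₀)
          :+ :- (z :* (ι :* ((con (+ 1) :+ b) :* (con (+ 1) :* (a :* con (+ 1))))
                       :+ ((con (+ 1) :+ b :* a) :* (con (+ 1) :* (con (+ 1) :* q₀))
                           :+ b :* (q₁ :* (con (+ 1) :* (a :* con (+ 1)))))))
          := (con (+ 1) :+ :- z :+ :- (z :* (b :* a))) :* (q₀ :+ :- (z :* ((a :* a) :* (ι :* (con (+ 1) :+ b) :+ b :* q₁))))
             :+ (z :* (a :* (ι :* (con (+ 1) :+ b) :+ b :* q₁))) :* (a :+ :- (con (+ 1) :+ z :* (con (+ 1) :* a :+ b :* (a :* a)))))
        ≈-refl

    peakDownSeries-suc : ∀ h → peakDownSeries (suc h) ≈ z ⊛ upSeries (suc h) ⊕ B ⊛ peakDownSeries h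
    peakDownSeries-suc h =
      ≈-modulo₂ _ _ (B ⊛ B ^ₛ h ⊛ A ^ₛ h ⊛ (levelAboveSum h ⊕ levelAbove (suc h))) A-defect
                    (B ⊛ B ^ₛ h ⊛ A ^ₛ h) (levelAbove-defect (suc h))
                    (identity A z B (B ^ₛ h) (A ^ₛ h) (levelAboveSum h) (levelAbove (suc h))
                              (const (𝟙 (suc (suc h) ≡ᵇ L))) (levelAbove (suc (suc h))))
                    A-defect≈𝟎 (levelAbove-defect≈𝟎 (suc h))
      where
      identity : ∀ a z b c p s q₁ ι q₂ →
        (b ⊛ c) ⊛ ((a ⊛ p) ⊛ (s ⊕ q₁))
          ⊕ ⊝ (z ⊛ (ι ⊛ ((𝟏 ⊕ b) ⊛ ((b ⊛ c) ⊛ (a ⊛ (a ⊛ p))))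
                    ⊕ ((𝟏 ⊕ b ⊛ a) ⊛ ((b ⊛ c) ⊛ ((a ⊛ p) ⊛ (s ⊕ q₁)))
                       ⊕ b ⊛ (q₂ ⊛ ((b ⊛ c) ⊛ (a ⊛ (a ⊛ p))))))
               ⊕ b ⊛ (c ⊛ (p ⊛ s)))
          ≈ (b ⊛ c ⊛ p ⊛ (s ⊕ q₁)) ⊛ (a ⊕ ⊝ (𝟏 ⊕ z ⊛ (𝟏 ⊛ a ⊕ b ⊛ (a ⊛ a))))
            ⊕ (b ⊛ c ⊛ p) ⊛ (q₁ ⊕ ⊝ (z ⊛ ((a ⊛ a) ⊛ (ι ⊛ (𝟏 ⊕ b) ⊕ b ⊛ q₂))))
      identity = solve 9 (λ a z b c p s q₁ ι q₂ →
        (b :* c) :* ((a :* p) :* (s :+ q₁))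
          :+ :- (z :* (ι :* ((con (+ 1) :+ b) :* ((b :* c) :* (a :* (a :* p))))
                       :+ ((con (+ 1) :+ b :* a) :* ((b :* c) :* ((a :* p) :* (s :+ q₁)))
                           :+ b :* (q₂ :* ((b :* c) :* (a :* (a :* p)))))) :+ b :* (c :* (p :* s)))
          := (b :* c :* p :* (s :+ q₁)) :* (a :+ :- (con (+ 1) :+ z :* (con (+ 1) :* a :+ b :* (a :* a))))
             :+ (b :* c :* p) :* (q₁ :+ :- (z :* ((a :* a) :* (ι :* (con (+ 1) :+ b) :+ b :* q₂)))))
        ≈-refl

    peakSeries-zero : ∀ prev → peakSeries prev 0 ≈ z ⊛ upSeries 0
    peakSeries-zero nothing  = peakDownSeries-zero
    peakSeries-zero (just _) = peakDownSeries-zero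

    peakSeries-suc : ∀ prev h → peakSeries prev (suc h) ≈ z ⊛ upSeries (suc h) ⊕ multSeries prev ⊛ peakDownSeries h
    peakSeries-suc (just _) h = peakDownSeries-suc h
    peakSeries-suc nothing  h =
      ≈-modulo _ _ 𝟏 _ (identity A B (B ^ₛ h) (A ^ₛ h) (levelAboveSum h) (levelAbove (suc h)) (upSeries (suc h)) z)
               (difference-≈𝟎 (peakDownSeries-suc h))
      where
      identity : ∀ a b c p s q₁ υ z →
        ((𝟏 ⊕ b ⊛ a) ⊛ (c ⊛ (p ⊛ s)) ⊕ b ⊛ (q₁ ⊛ (c ⊛ (a ⊛ p))))
          ⊕ ⊝ (z ⊛ υ ⊕ (𝟏 ⊕ b) ⊛ (c ⊛ (p ⊛ s)))
          ≈ 𝟏 ⊛ ((b ⊛ c) ⊛ ((a ⊛ p) ⊛ (s ⊕ q₁)) ⊕ ⊝ (z ⊛ υ ⊕ b ⊛ (c ⊛ (p ⊛ s))))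
      identity = solve 8 (λ a b c p s q₁ υ z →
        ((con (+ 1) :+ b :* a) :* (c :* (p :* s)) :+ b :* (q₁ :* (c :* (a :* p))))
          :+ :- (z :* υ :+ (con (+ 1) :+ b) :* (c :* (p :* s)))
          := con (+ 1) :* ((b :* c) :* ((a :* p) :* (s :+ q₁)) :+ :- (z :* υ :+ b :* (c :* (p :* s)))))
        ≈-refl

    peakTotal : Maybe (Fin r) → ℕ → ℕ → ℤ
    peakTotal = admissibleTotal peaks

    upTotal : ∀ h m → peakTotal nothing (suc h) m ≡ heightCoeff (peakSeries nothing (suc h)) (suc h) m →
      sumL (λ w → 𝟙 (admissible nothing (suc h) w) * peaks h (u ∷ w)) (words r m) ≡ heightCoeff (upSeries h) (suc h) m
    upTotal h m ih =
      begin
        sumL (λ w → 𝟙 (admissible nothing (suc h) w) * peaks h (u ∷ w)) (words r m)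
      ≡⟨ sumL-cong (words r m) (λ w → trans (cong (𝟙 (admissible nothing (suc h) w) *_) (peaks-u h w))
                                             (distribute (𝟙 (admissible nothing (suc h) w)) ι (startsDown w) (peaks (suc h) w))) ⟩
        sumL (λ w → ι * (𝟙 (admissible nothing (suc h) w) * startsDown w)
                    + 𝟙 (admissible nothing (suc h) w) * peaks (suc h) w) (words r m)
      ≡⟨ sumL-distrib-+ (λ w → ι * (𝟙 (admissible nothing (suc h) w) * startsDown w)) _ (words r m) ⟩
        sumL (λ w → ι * (𝟙 (admissible nothing (suc h) w) * startsDown w)) (words r m) + peakTotal nothing (suc h) m
      ≡⟨ cong₂ _+_ (trans (sumL-*ˡ ι (λ w → 𝟙 (admissible nothing (suc h) w) * startsDown w) (words r m))
                          (cong (ι *_) (startsDown-total h m)))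
                   ih ⟩
        ι * (+ r * heightCoeff (downSeries h) (suc h) m) + heightCoeff (peakSeries nothing (suc h)) (suc h) m
      ≡⟨ cong (_+ heightCoeff (peakSeries nothing (suc h)) (suc h) m)
              (trans (heightCoeff-const⊛ ι (R ⊛ downSeries h) (suc h) m)
                     (cong (ι *_) (heightCoeff-multSeries nothing (downSeries h) (suc h) m))) ⟨
        heightCoeff (const ι ⊛ (R ⊛ downSeries h)) (suc h) m + heightCoeff (peakSeries nothing (suc h)) (suc h) m
      ≡⟨ heightCoeff-⊕ (const ι ⊛ (R ⊛ downSeries h)) (peakSeries nothing (suc h)) (suc h) m ⟨
        heightCoeff (upSeries h) (suc h) m
      ∎
      where
      open ≡-Reasoning
      ι = 𝟙 (suc h ≡ᵇ L)
      distribute : ∀ x ι s p → x * (ι * s + p) ≡ ι * (x * s) + x * p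
      distribute = solve-∀

    peakTotal-series : ∀ m prev h → peakTotal prev h m ≡ heightCoeff (peakSeries prev h) h m
    peakTotal-series zero    prev zero    =
      trans (ℤ.+-identityʳ _)
            (trans (ℤ.*-zeroʳ (𝟙 (admissible prev 0 [])))
                   (sym (trans (peakSeries-head prev) (cong (λ q → + 1 * (+ 1 * q)) (levelSeries-head L)))))
      where
      peakSeries-head : ∀ prev → peakSeries prev 0 0 ≡ + 1 * (+ 1 * levelAbove 0 0)
      peakSeries-head nothing  = refl
      peakSeries-head (just _) = refl
    peakTotal-series zero    prev (suc h) = trans (ℤ.+-identityʳ _) (ℤ.*-zeroʳ (𝟙 (admissible prev (suc h) [])))
    peakTotal-series (suc m) prev zero    =
      begin
        peakTotal prev 0 (suc m)
      ≡⟨ admissibleTotal-suc peaks prev 0 m ⟩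
        sumL (λ w → 𝟙 (admissible nothing 1 w) * peaks 0 (u ∷ w)) (words r m) + downTotal peaks prev 0 m
      ≡⟨ cong₂ _+_ (upTotal 0 m (peakTotal-series m nothing 1)) (downTotal-zero peaks prev m) ⟩
        heightCoeff (upSeries 0) 1 m + + 0
      ≡⟨ ℤ.+-identityʳ _ ⟩
        heightCoeff (upSeries 0) 1 m
      ≡⟨ heightCoeff-z⊛ (upSeries 0) 0 m ⟨
        heightCoeff (z ⊛ upSeries 0) 0 (suc m)
      ≡⟨ heightCoeff-cong (peakSeries-zero prev) 0 (suc m) ⟨
        heightCoeff (peakSeries prev 0) 0 (suc m)
      ∎
      where open ≡-Reasoning
    peakTotal-series (suc m) prev (suc h) =
      begin
        peakTotal prev (suc h) (suc m)
      ≡⟨ admissibleTotal-suc peaks prev (suc h) m ⟩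
        sumL (λ w → 𝟙 (admissible nothing (suc (suc h)) w) * peaks (suc h) (u ∷ w)) (words r m) + downTotal peaks prev (suc h) m
      ≡⟨ cong₂ _+_ (upTotal (suc h) m (peakTotal-series m nothing (suc (suc h))))
                   (downTotal-suc peaks peaks (λ _ _ _ → refl) prev h m _ (λ c → peakTotal-series m (just c) h)) ⟩
        heightCoeff (upSeries (suc h)) (suc (suc h)) m + multiplicity prev * heightCoeff (peakDownSeries h) h m
      ≡⟨ cong₂ _+_ (heightCoeff-z⊛ (upSeries (suc h)) (suc h) m)
                   (heightCoeff-multSeries prev (peakDownSeries h) (suc h) (suc m)) ⟨
        heightCoeff (z ⊛ upSeries (suc h)) (suc h) (suc m) + heightCoeff (multSeries prev ⊛ peakDownSeries h) (suc h) (suc m)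
      ≡⟨ heightCoeff-⊕ (z ⊛ upSeries (suc h)) (multSeries prev ⊛ peakDownSeries h) (suc h) (suc m) ⟨
        heightCoeff (z ⊛ upSeries (suc h) ⊕ multSeries prev ⊛ peakDownSeries h) (suc h) (suc m)
      ≡⟨ heightCoeff-cong (peakSeries-suc prev h) (suc h) (suc m) ⟨
        heightCoeff (peakSeries prev (suc h)) (suc h) (suc m)
      ∎
      where open ≡-Reasoning

  sum-filterB : ∀ {X : Set} (P : X → Bool) (f : X → ℕ) xs →
    + sum (map f (filterB P xs)) ≡ sumL (λ x → 𝟙 (P x) * + f x) xs
  sum-filterB P f []       = refl
  sum-filterB P f (x ∷ xs) with P x
  ... | true  = trans (ℤ.pos-+ (f x) (sum (map f (filterB P xs))))
                      (cong₂ _+_ (sym (ℤ.*-identityˡ (+ f x))) (sum-filterB P f xs))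
  ... | false = trans (sum-filterB P f xs) (sym (ℤ.+-identityˡ _))

  peak-count≡levelSeries : ∀ n ℓ → + p r n ℓ ≡ levelSeries (suc ℓ) (suc n)
  peak-count≡levelSeries n ℓ =
    begin
      + p r n ℓ
    ≡⟨ sum-filterB (admissible nothing 0) (peaksAtLevel (suc ℓ)) (words r (2 ℕ.* suc n)) ⟩
      peakTotal nothing 0 (2 ℕ.* suc n)
    ≡⟨ peakTotal-series (2 ℕ.* suc n) nothing 0 ⟩
      heightCoeff (peakSeries nothing 0) 0 (2 ℕ.* suc n)
    ≡⟨ cong (heightCoeff (peakSeries nothing 0) 0) (2[n+1]≡[n+1]+[n+1] n) ⟩
      heightCoeff (peakSeries nothing 0) 0 (suc n ℕ.+ suc n)
    ≡⟨ heightCoeff-even (peakSeries nothing 0) (suc n) ⟩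
      (𝟏 ⊛ (𝟏 ⊛ levelSeries (suc ℓ))) (suc n)
    ≡⟨ ≈-trans (⊛-identityˡ (𝟏 ⊛ levelSeries (suc ℓ))) (⊛-identityˡ (levelSeries (suc ℓ))) (suc n) ⟩
      levelSeries (suc ℓ) (suc n)
    ∎
    where
    open ≡-Reasoning
    open AtLevel (suc ℓ)
    2[n+1]≡[n+1]+[n+1] : ∀ n → 2 ℕ.* suc n ≡ suc n ℕ.+ suc n
    2[n+1]≡[n+1]+[n+1] = ℕ-Solver.solve-∀

  signed-peak-count : ∀ n ℓ → (- + 1) ^ ℓ * + p r n ℓ ≡ + r * G ℓ 2 n
  signed-peak-count n ℓ =
    begin
      (- + 1) ^ ℓ * + p r n ℓ
    ≡⟨ cong ((- + 1) ^ ℓ *_) (trans (peak-count≡levelSeries n ℓ) (z⊛-suc (R ⊛ (B ^ₛ ℓ ⊛ X)) n)) ⟩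
      (- + 1) ^ ℓ * (R ⊛ (B ^ₛ ℓ ⊛ X)) n
    ≡⟨ cong ((- + 1) ^ ℓ *_) (trans (R⊛ (B ^ₛ ℓ ⊛ X) n)
                                    (cong (+ r *_) (trans (⊛-congˡ X (const-^ₛ (+ r′) ℓ) n)
                                                          (const-⊛ ((+ r′) ^ ℓ) X n)))) ⟩
      (- + 1) ^ ℓ * (+ r * ((+ r′) ^ ℓ * X n))
    ≡⟨ regroup ((- + 1) ^ ℓ) (+ r) ((+ r′) ^ ℓ) (X n) ⟩
      + r * (((- + 1) ^ ℓ * (+ r′) ^ ℓ) * X n)
    ≡⟨ cong (λ c → + r * (c * X n)) (trans (sym (^-distrib-* (- + 1) (+ r′) ℓ)) (cong (_^ ℓ) (ℤ.-1*i≡-i (+ r′)))) ⟩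
      + r * ((- + r′) ^ ℓ * X n)
    ≡⟨ cong (+ r *_) (const-⊛ ((- + r′) ^ ℓ) X n) ⟨
      + r * G ℓ 2 n
    ∎
    where
    open ≡-Reasoning
    X = z ^ₛ ℓ ⊛ A ^ₛ (ℓ ℕ.+ ℓ ℕ.+ 2)
    regroup : ∀ s r c x → s * (r * (c * x)) ≡ r * ((s * c) * x)
    regroup = solve-∀

module Identities (r′ : ℕ) where

  open import Data.Nat using (suc; _∸_)
  open import Data.Integer using (ℤ; +_; -_; _+_; _-_; _*_; _^_)
  open import Data.Integer.Properties as ℤ using ()
  open import Data.Integer.Tactic.RingSolver using (solve-∀)
  open import Relation.Binary.PropositionalEquality
  open import Defs using (Σℤ; S; Sr; p)
  open PowerSeries
  open SchröderSeries using (Σℤ≡sum≤; S-sign-flip)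
  open Substitution (+ r′)
  open PathCounting r′ using (r; signed-peak-count)

  flipped-S≡Y : ∀ m → (- + 1) ^ m * S (- + 1) ((+ r′) ^ 2) m ≡ Y m
  flipped-S≡Y m =
    trans (S-sign-flip (+ 1) ((+ r′) ^ 2) m) (cong (λ c → S (+ 1) (- c) m) (cong (+ r′ *_) (ℤ.*-identityʳ (+ r′))))

  signed-peaks-S : ∀ n → Σℤ n (λ ℓ → ((- + 1) ^ ℓ) * (+ p r n ℓ) * Sr r ℓ) ≡ + r * (A ⊛ Y) n
  signed-peaks-S n =
    begin
      Σℤ n (λ ℓ → (- + 1) ^ ℓ * + p r n ℓ * A ℓ)
    ≡⟨ Σℤ≡sum≤ n _ ⟩
      sum≤ n (λ ℓ → (- + 1) ^ ℓ * + p r n ℓ * A ℓ)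
    ≡⟨ sum≤-cong n (λ ℓ → trans (cong (_* A ℓ) (signed-peak-count n ℓ)) (swap (+ r) (G ℓ 2 n) (A ℓ))) ⟩
      sum≤ n (λ ℓ → + r * (A ℓ * G ℓ 2 n))
    ≡⟨ sum≤-*ˡ n (+ r) _ ⟩
      + r * sum≤ n (λ ℓ → A ℓ * G ℓ 2 n)
    ≡⟨ cong (+ r *_) (sum-A-G n) ⟩
      + r * (A ⊛ Y) n
    ∎
    where
    open ≡-Reasoning
    swap : ∀ r g a → r * g * a ≡ r * (a * g)
    swap = solve-∀

  signed-peaks-ΔS : ∀ n →
    + r′ * Σℤ n (λ ℓ → ((- + 1) ^ ℓ) * (+ p r n ℓ) * (Sr r (suc ℓ) - Sr r ℓ)) ≡ + r * (- Y (suc n) + Y n)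
  signed-peaks-ΔS n =
    begin
      + r′ * Σℤ n (λ ℓ → (- + 1) ^ ℓ * + p r n ℓ * (A (suc ℓ) - A ℓ))
    ≡⟨ cong (+ r′ *_) (Σℤ≡sum≤ n _) ⟩
      + r′ * sum≤ n (λ ℓ → (- + 1) ^ ℓ * + p r n ℓ * (A (suc ℓ) - A ℓ))
    ≡⟨ cong (+ r′ *_) (sum≤-cong n (λ ℓ → trans (cong (_* (A (suc ℓ) - A ℓ)) (signed-peak-count n ℓ))
                                                (split (+ r) (G ℓ 2 n) (A (suc ℓ)) (A ℓ)))) ⟩
      + r′ * sum≤ n (λ ℓ → + r * (A (suc ℓ) * G ℓ 2 n) + - + r * (A ℓ * G ℓ 2 n))
    ≡⟨ cong (+ r′ *_) (sum≤-linear n (+ r) (- + r) _ _) ⟩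
      + r′ * (+ r * sum≤ n (λ ℓ → A (suc ℓ) * G ℓ 2 n) + - + r * sum≤ n (λ ℓ → A ℓ * G ℓ 2 n))
    ≡⟨ telescope (+ r′) (+ r) _ _ (Y (suc n)) (Y n) ((A ⊛ Y) n) (sum-A-suc-G n) (sum-A-G n) ⟩
      + r * (- Y (suc n) + Y n)
    ∎
    where
    open ≡-Reasoning
    split : ∀ r g a₁ a₀ → r * g * (a₁ - a₀) ≡ r * (a₁ * g) + - r * (a₀ * g)
    split = solve-∀
    telescope : ∀ b r s₁ s₀ y₁ y₀ ay → - b * s₁ ≡ y₁ + - y₀ + - (b * ay) → s₀ ≡ ay →
                b * (r * s₁ + - r * s₀) ≡ r * (- y₁ + y₀)
    telescope b r s₁ s₀ y₁ y₀ ay e₁ e₀ =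
      trans (expand b r s₁ s₀) (trans (cong₂ (λ x y → r * (- x) + - r * (b * y)) e₁ e₀) (collect b r y₁ y₀ ay))
      where
      expand : ∀ b r s₁ s₀ → b * (r * s₁ + - r * s₀) ≡ r * (- (- b * s₁)) + - r * (b * s₀)
      expand = solve-∀
      collect : ∀ b r y₁ y₀ ay → r * (- (y₁ + - y₀ + - (b * ay))) + - r * (b * ay) ≡ r * (- y₁ + y₀)
      collect = solve-∀

  first-identity : ∀ n →
    Σℤ n (λ ℓ → ((- + 1) ^ ℓ) * (+ p r n ℓ) * Sr r ℓ)
      ≡ + r * Σℤ n (λ ℓ → ((- + 1) ^ (n ∸ ℓ)) * Sr r ℓ * S (- + 1) ((+ (r ∸ 1)) ^ 2) (n ∸ ℓ))
  first-identity n =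
    trans (signed-peaks-S n)
          (cong (+ r *_) (sym (trans (Σℤ≡sum≤ n _) (sum≤-cong n (λ ℓ →
            trans (swap ((- + 1) ^ (n ∸ ℓ)) (A ℓ) _) (cong (A ℓ *_) (flipped-S≡Y (n ∸ ℓ))))))))
    where
    swap : ∀ s a t → s * a * t ≡ a * (s * t)
    swap = solve-∀

  second-identity : ∀ n →
    + (r ∸ 1) * Σℤ n (λ ℓ → ((- + 1) ^ ℓ) * (+ p r n ℓ) * (Sr r (suc ℓ) - Sr r ℓ))
      ≡ + r * ((- + 1) ^ n) * (S (- + 1) ((+ (r ∸ 1)) ^ 2) (suc n) + S (- + 1) ((+ (r ∸ 1)) ^ 2) n)
  second-identity n =
    trans (signed-peaks-ΔS n)
          (sym (trans (alternate (+ r) ((- + 1) ^ n) _ _)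
                      (cong₂ (λ y₁ y₀ → + r * (- y₁ + y₀)) (flipped-S≡Y (suc n)) (flipped-S≡Y n))))
    where
    alternate : ∀ r s t₁ t₀ → r * s * (t₁ + t₀) ≡ r * (- ((- + 1) * s * t₁) + s * t₀)
    alternate = solve-∀

open import Data.Nat using (ℕ; zero; suc; _≤_; _∸_)
open import Data.Integer using (ℤ; +_; -_; _+_; _-_; _*_; _^_)
open import Data.Integer.Properties as ℤ using ()
open import Data.Product using (_×_; _,_)
open import Relation.Binary.PropositionalEquality
open import Defs
open PowerSeries
open Identities using (first-identity; second-identity)

module LargeSchröder where

  open Substitution (+ 1)
  open Identities 1 using (signed-peaks-S; signed-peaks-ΔS)

  Y≈𝟏 : Y ≈ 𝟏
  Y≈𝟏 = quadratic-unique 𝟏 (⊝ (B ⊛ B)) Y 𝟏 Y-equation 𝟏-equation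
    where
    𝟏-equation : 𝟏 ≈ 𝟏 ⊕ z ⊛ (𝟏 ⊛ 𝟏 ⊕ ⊝ (𝟏 ⊛ 𝟏) ⊛ (𝟏 ⊛ 𝟏))
    𝟏-equation = solve 1 (λ x →
      con (+ 1) := con (+ 1) :+ x :* (con (+ 1) :* con (+ 1) :+ :- (con (+ 1) :* con (+ 1)) :* (con (+ 1) :* con (+ 1))))
      ≈-refl z

  schröder-first : ∀ n → Σℤ n (λ ℓ → ((- + 1) ^ ℓ) * (+ p 2 n ℓ) * Schröder ℓ) ≡ + 2 * Schröder n
  schröder-first n = trans (signed-peaks-S n) (cong (+ 2 *_) (trans (⊛-congʳ A Y≈𝟏 n) (⊛-identityʳ A n)))

  schröder-second : ∀ n → Σℤ n (λ ℓ → ((- + 1) ^ ℓ) * (+ p 2 n ℓ) * (Schröder (suc ℓ) - Schröder ℓ)) ≡ + 2 * δ0 n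
  schröder-second n =
    trans (sym (ℤ.*-identityˡ _))
          (trans (signed-peaks-ΔS n)
                 (cong (+ 2 *_) (trans (cong₂ (λ y₁ y₀ → - y₁ + y₀) (Y≈𝟏 (suc n)) (Y≈𝟏 n)) (δ n))))
    where
    δ : ∀ n → - 𝟏 (suc n) + 𝟏 n ≡ δ0 n
    δ zero    = refl
    δ (suc n) = refl

open LargeSchröder using (schröder-first; schröder-second)

-- The identities hold for every r ≥ 1; the hypothesis 2 ≤ r only excludes r = 0.
corollary5p2 : (∀ (r n : ℕ) → 2 ≤ r →
    (Σℤ n (λ ℓ → ((- + 1) ^ ℓ) * (+ p r n ℓ) * Sr r ℓ)
    ≡ + r * Σℤ n (λ ℓ → ((- + 1) ^ (n ∸ ℓ)) * Sr r ℓ * S (- + 1) ((+ (r ∸ 1)) ^ 2) (n ∸ ℓ)))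
    ×
    (+ (r ∸ 1) * Σℤ n (λ ℓ → ((- + 1) ^ ℓ) * (+ p r n ℓ) * (Sr r (suc ℓ) - Sr r ℓ))
    ≡ + r * ((- + 1) ^ n) * (S (- + 1) ((+ (r ∸ 1)) ^ 2) (suc n) + S (- + 1) ((+ (r ∸ 1)) ^ 2) n)))
    ×
    (∀ (n : ℕ) →
    (Σℤ n (λ ℓ → ((- + 1) ^ ℓ) * (+ p 2 n ℓ) * Schröder ℓ) ≡ + 2 * Schröder n)
    ×
    (Σℤ n (λ ℓ → ((- + 1) ^ ℓ) * (+ p 2 n ℓ) * (Schröder (suc ℓ) - Schröder ℓ)) ≡ + 2 * δ0 n))
corollary5p2 =
  (λ { zero _ () ; (suc r′) n _ → first-identity r′ n , second-identity r′ n }) ,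
  (λ n → schröder-first n , schröder-second n)
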